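{- Let $p\ge 7$ be a prime, let $c$ be an integer with $p\nmid c$, and let $e$ be any integer. Let $R(f)\subseteq\{0,1,\ldots,p-1\}$ denote the set of distinct residues of $f(x)$ modulo $p$ as $x$ ranges over the integers, and let $\sum R(f)$ denote the sum of the elements of this set. Then $$\sum R(x^4+cx^2+e)\equiv Vc^2+We \pmod p,$$ where $V$ and $W$ (fractions being interpreted as elements of $\mathbb{Z}/p\mathbb{Z}$, i.e. denominators are inverted modulo $p$) are given by: \begin{itemize} \item $p\equiv 1\pmod 8$, $\left(\frac{c}{p}\right)=1$: $V=-\frac{9}{64}$, $W=\frac{5}{8}$; \item $p\equiv 3\pmod 8$, $\left(\frac{c}{p}\right)=1$: $V=-\frac{7}{64}$, $W=\frac{7}{8}$; \item $p\equiv 5\pmod 8$, $\left(\frac{c}{p}\right)=1$: $V=-\frac{1}{64}$, $W=\frac{1}{8}$; \item $p\equiv 7\pmod 8$, $\left(\frac{c}{p}\right)=1$: $V=\frac{1}{64}$, $W=\frac{3}{8}$; \item $p\equiv 1\pmod 8$, $\left(\frac{c}{p}\right)=-1$: $V=-\frac{1}{64}$, $W=\frac{5}{8}$; \item $p\equiv 3\pmod 8$, $\left(\frac{c}{p}\right)=-1$: $V=\frac{1}{64}$, $W=-\frac{1}{8}$; \item $p\equiv 5\pmod 8$, $\left(\frac{c}{p}\right)=-1$: $V=-\frac{9}{64}$, $W=\frac{9}{8}$; \item $p\equiv 7\pmod 8$, $\left(\frac{c}{p}\right)=-1$: $V=-\frac{7}{64}$, $W=\frac{3}{8}$. \end{i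temize}
   Context: $\left(\frac{c}{p}\right)$ denotes the Legendre symbol. For an integer polynomial $f$, $R(f)=R_p(f)=\{f(x)\bmod p: x\in\mathbb{Z}\}$, viewed as a subset of $\{0,1,\ldots,p-1\}$ (each residue counted once). -}

module Defs where

open import Data.Nat as ℕ using (ℕ)
open import Data.Integer using (ℤ; +_; -_; _+_; _-_; _*_; _^_)
open import Data.Integer.Divisibility using (_∣_)
open import Data.List using (List)
open import Data.Product using (∃-syntax; _×_)
open import Relation.Nullary using (¬_)

QuadRes : ℕ → ℤ → Set
QuadRes p c = ∃[ x ] (+ p ∣ (x * x - c))

data Legendre (p : ℕ) (c : ℤ) : ℤ → Set where
  leg-zero   : + p ∣ c → Legendre p c (+ 0)
  leg-res    : ¬ (+ p ∣ c) → QuadRes p c → Legendre p c (+ 1)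
  leg-nonres : ¬ (+ p ∣ c) → ¬ QuadRes p c → Legendre p c (- (+ 1))

quartic : ℤ → ℤ → ℤ → ℤ
quartic c e x = x ^ 4 + c * x ^ 2 + e

IsResidueSet : ℕ → (ℤ → ℤ) → List ℕ → Set
IsResidueSet p f L =
  Unique L × (∀ r → (r ∈ L) ⇔ ((r ℕ.< p) × ∃[ x ] (+ p ∣ (f x - + r))))
  where
    open import Data.List.Relation.Unary.Unique.Propositional using (Unique)
    open import Data.List.Membership.Propositional using (_∈_)
    open import Function.Bundles using (_⇔_)

-- S ≡ V c^2 + W e (mod p) with V = v/64 and W = w/8, where division means
-- multiplication by an inverse of 64 (resp. 8) modulo p.  For any i with
-- 64 i ≡ 1 (mod p), 1/64 = i and 1/8 = 8 i.
CongVW : ℕ → ℤ → ℤ → ℤ → ℤ → ℤ → Set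
CongVW p S c e v w =
  ∀ (i : ℤ) → + p ∣ (+ 64 * i - + 1) →
    + p ∣ (S - ((v * i) * (c * c) + (w * (+ 8 * i)) * e))

module Submission where

-- Write x⁴ + c x² + e = (x² + h)² + k with h = c/2.  A residue r is a value iff r − k ≡ u²
-- for some u with u − h a square, so with g the indicator of such r − k the sum of the values
-- is A + k B, where A = ∑ d g(d) and B = ∑ g(d).  Summing over d = s² instead (every nonzero
-- value of g is a square with two roots) turns A and B into sums of s² g(s²) and g(s²), and
-- g(s²) is a polynomial in the quadratic characters of s − h and −s − h, which Euler's
-- criterion expresses through (s ∓ h)^m, m = (p − 1)/2.  Every remaining sum is a power sum
-- ∑ sʲ, which vanishes mod p unless p − 1 divides j.  What is left depends only on (−1)^m,
-- c^m ≡ (c/p) and 2^(−m) ≡ (2/p); the last is computed from (1 + i)^p ≡ 1 + i^p.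

open import Defs
open import Data.Nat as ℕ using (ℕ; zero; suc; z≤n; s≤s; _∸_; _≤_; _%_; _/_)
import Data.Nat.Properties as ℕₚ
open import Data.Nat.Combinatorics using (_C_; nCn≡1; nC1≡n; nCk≡nC[n∸k]; nCk+nC[k+1]≡[n+1]C[k+1]; k>n⇒nCk≡0)
open import Data.Nat.Divisibility using () renaming (_∣_ to _∣ℕ_)
import Data.Nat.Divisibility as ℕ∣
open import Data.Nat.DivMod using (m≡m%n+[m/n]*n; [m+kn]%n≡m%n; m%n<n; m<n⇒m%n≡m)
open import Data.Nat.Induction using (<-rec)
open import Data.Nat.Primality using (Prime; euclidsLemma; ¬prime[1]; prime⇒irreducible)
open import Data.Nat.ListAction using (sum)
open import Data.Nat.Tactic.RingSolver using () renaming (solve-∀ to solve-ℕ)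
open import Data.Fin using (toℕ)
open import Data.Integer as ℤ using (ℤ; +_; -_; _+_; _*_; _-_; 0ℤ; 1ℤ; _^_)
import Data.Integer.Properties as ℤₚ
open import Data.Integer.Divisibility using (_∣_)
open import Data.Integer.Divisibility.Signed using (divides; ∣ᵤ⇒∣; ∣⇒∣ᵤ; _∣?_) renaming (_∣_ to _∣ₛ_)
open import Data.Integer.DivMod using (_%ℕ_; _/ℕ_; a≡a%ℕn+[a/ℕn]*n; n%ℕd<d)
open import Data.Integer.Tactic.RingSolver using (solve-∀)
open import Data.Empty using (⊥; ⊥-elim)
open import Data.Product as Product using (∃; _×_; _,_; proj₁; proj₂)
open import Data.Sum as Sum using (_⊎_; inj₁; inj₂; [_,_]′)
open import Data.List using (List; []; _∷_)
open import Data.List.Membership.Propositional using (_∈_)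
import Data.List.Relation.Unary.All as All
open import Data.List.Relation.Unary.AllPairs using ([]; _∷_)
open import Data.List.Relation.Unary.Any using (here; there)
open import Data.List.Relation.Unary.Unique.Propositional using (Unique)
open import Function using (id)
open import Function.Bundles using (_⇔_; mk⇔; Equivalence)
open import Relation.Nullary using (Dec; yes; no; ¬_; ¬?; _×-dec_)
open import Relation.Nullary.Decidable using (map′)
open import Relation.Binary.Bundles using (Setoid)
open import Relation.Binary.Core using (_Preserves_⟶_)
open import Relation.Binary.Definitions using (Tri; tri<; tri≈; tri>)
open import Relation.Binary.PropositionalEquality
import Relation.Binary.Reasoning.Setoid as SetoidReasoning
import Algebra.Properties.Semiring.Binomial as Binomial
import Algebra.Definitions.RawSemiring as RawSemiring
import Algebra.Definitions.RawMonoid as RawMonoid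

∑ : ℕ → (ℕ → ℤ) → ℤ
∑ zero    f = 0ℤ
∑ (suc n) f = f 0 + ∑ n (λ i → f (suc i))

𝟙 : ∀ {a} {P : Set a} → Dec P → ℤ
𝟙 (yes _) = 1ℤ
𝟙 (no _)  = 0ℤ

𝟙-cong : ∀ {a b} {P : Set a} {Q : Set b} (P? : Dec P) (Q? : Dec Q) → (P → Q) → (Q → P) → 𝟙 P? ≡ 𝟙 Q?
𝟙-cong (yes _) (yes _) _ _ = refl
𝟙-cong (no _)  (no _)  _ _ = refl
𝟙-cong (yes p) (no ¬q) f _ = ⊥-elim (¬q (f p))
𝟙-cong (no ¬p) (yes q) _ g = ⊥-elim (¬p (g q))

𝟙-no : ∀ {a} {P : Set a} (P? : Dec P) → ¬ P → 𝟙 P? ≡ 0ℤ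
𝟙-no (yes p) ¬p = ⊥-elim (¬p p)
𝟙-no (no _)  _  = refl

𝟙-⊎ : ∀ {P Q R : Set} (P? : Dec P) (Q? : Dec Q) (R? : Dec R) → (R → P ⊎ Q) → (P → R) → (Q → R) →
      𝟙 R? ≡ 𝟙 P? + 𝟙 Q? - 𝟙 P? * 𝟙 Q?
𝟙-⊎ (yes _) (yes _) (yes _) _ _ _ = refl
𝟙-⊎ (yes _) (no _)  (yes _) _ _ _ = refl
𝟙-⊎ (no _)  (yes _) (yes _) _ _ _ = refl
𝟙-⊎ (no ¬p) (no ¬q) (yes r) to _ _ = ⊥-elim ([ ¬p , ¬q ]′ (to r))
𝟙-⊎ (yes p) _       (no ¬r) _ fromP _ = ⊥-elim (¬r (fromP p))
𝟙-⊎ (no _)  (yes q) (no ¬r) _ _ fromQ = ⊥-elim (¬r (fromQ q))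
𝟙-⊎ (no _)  (no _)  (no _)  _ _ _ = refl

∑-cong : ∀ n {f g : ℕ → ℤ} → (∀ i → i ℕ.< n → f i ≡ g i) → ∑ n f ≡ ∑ n g
∑-cong zero    f≡g = refl
∑-cong (suc n) f≡g = cong₂ _+_ (f≡g 0 (s≤s z≤n)) (∑-cong n (λ i i<n → f≡g (suc i) (s≤s i<n)))

∑-distrib-+ : ∀ n (f g : ℕ → ℤ) → ∑ n (λ i → f i + g i) ≡ ∑ n f + ∑ n g
∑-distrib-+ zero    f g = refl
∑-distrib-+ (suc n) f g =
  trans (cong (_+_ (f 0 + g 0)) (∑-distrib-+ n _ _)) (interchange (f 0) (g 0) (∑ n _) (∑ n _))
  where
  interchange : ∀ a b c d → a + b + (c + d) ≡ a + c + (b + d)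
  interchange = solve-∀

∑-neg : ∀ n (f : ℕ → ℤ) → ∑ n (λ i → - f i) ≡ - ∑ n f
∑-neg zero    f = refl
∑-neg (suc n) f = trans (cong (_+_ (- f 0)) (∑-neg n _)) (sym (ℤₚ.neg-distrib-+ (f 0) _))

∑-distrib-minus : ∀ n (f g : ℕ → ℤ) → ∑ n (λ i → f i - g i) ≡ ∑ n f - ∑ n g
∑-distrib-minus n f g = trans (∑-distrib-+ n f (λ i → - g i)) (cong (_+_ (∑ n f)) (∑-neg n g))

∑-*ˡ : ∀ n (c : ℤ) (f : ℕ → ℤ) → ∑ n (λ i → c * f i) ≡ c * ∑ n f
∑-*ˡ zero    c f = sym (ℤₚ.*-zeroʳ c)
∑-*ˡ (suc n) c f = trans (cong (_+_ (c * f 0)) (∑-*ˡ n c _)) (sym (ℤₚ.*-distribˡ-+ c (f 0) _))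

∑-zero : ∀ n → ∑ n (λ _ → 0ℤ) ≡ 0ℤ
∑-zero zero    = refl
∑-zero (suc n) = cong (_+_ 0ℤ) (∑-zero n)

∑-const : ∀ n c → ∑ n (λ _ → c) ≡ + n * c
∑-const zero    c = sym (ℤₚ.*-zeroˡ c)
∑-const (suc n) c = trans (cong (_+_ c) (∑-const n c)) (lemma c (+ n))
  where
  lemma : ∀ c n → c + n * c ≡ (1ℤ + n) * c
  lemma = solve-∀

∑-snoc : ∀ n (f : ℕ → ℤ) → ∑ (suc n) f ≡ ∑ n f + f n
∑-snoc zero    f = trans (ℤₚ.+-identityʳ (f 0)) (sym (ℤₚ.+-identityˡ (f 0)))
∑-snoc (suc n) f = trans (cong (_+_ (f 0)) (∑-snoc n (λ i → f (suc i)))) (sym (ℤₚ.+-assoc (f 0) _ _))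

∑-comm : ∀ n k (f : ℕ → ℕ → ℤ) → ∑ n (λ i → ∑ k (f i)) ≡ ∑ k (λ j → ∑ n (λ i → f i j))
∑-comm zero    k f = sym (∑-zero k)
∑-comm (suc n) k f = trans (cong (_+_ (∑ k (f 0))) (∑-comm n k (λ i → f (suc i))))
                           (sym (∑-distrib-+ k (f 0) (λ j → ∑ n (λ i → f (suc i) j))))

∑-telescope : ∀ n (f : ℕ → ℤ) → ∑ n (λ i → f (suc i) - f i) ≡ f n - f 0
∑-telescope zero    f = sym (ℤₚ.+-inverseʳ (f 0))
∑-telescope (suc n) f =
  trans (cong (_+_ (f 1 - f 0)) (∑-telescope n (λ i → f (suc i)))) (lemma (f 0) (f 1) (f (suc n)))
  where
  lemma : ∀ a b c → b - a + (c - b) ≡ c - a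
  lemma = solve-∀

∑-𝟙-≡ : ∀ n k (g : ℕ → ℤ) → k ℕ.< n → ∑ n (λ i → 𝟙 (i ℕ.≟ k) * g i) ≡ g k
∑-𝟙-≡ (suc n) zero g _ =
  trans (cong (_+_ (1ℤ * g 0)) (trans (∑-cong n (λ i _ → ℤₚ.*-zeroˡ (g (suc i)))) (∑-zero n)))
        (trans (ℤₚ.+-identityʳ (1ℤ * g 0)) (ℤₚ.*-identityˡ (g 0)))
∑-𝟙-≡ (suc n) (suc k) g (s≤s k<n) =
  trans (cong (_+ rest) (ℤₚ.*-zeroˡ (g 0)))
        (trans (ℤₚ.+-identityˡ rest)
               (trans (∑-cong n (λ i _ → cong (_* g (suc i)) (𝟙-cong (suc i ℕ.≟ suc k) (i ℕ.≟ k) ℕₚ.suc-injective (cong suc))))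
                      (∑-𝟙-≡ n k (λ i → g (suc i)) k<n)))
  where
  rest = ∑ n (λ i → 𝟙 (suc i ℕ.≟ suc k) * g (suc i))

sum≡∑-𝟙 : ∀ (L : List ℕ) n {Q : ℕ → Set} (Q? : ∀ r → Dec (Q r)) → Unique L →
          (∀ r → r ∈ L ⇔ (r ℕ.< n × Q r)) → + sum L ≡ ∑ n (λ r → 𝟙 (Q? r) * + r)
sum≡∑-𝟙 [] n Q? _ mem =
  sym (trans (∑-cong n (λ r r<n → trans (cong (_* + r) (𝟙-no (Q? r) (λ q → ∉[] (Equivalence.from (mem r) (r<n , q)))))
                                        (ℤₚ.*-zeroˡ (+ r))))
             (∑-zero n))
  where
  ∉[] : ∀ {r} → r ∈ [] → ⊥
  ∉[] ()
sum≡∑-𝟙 (x ∷ L) n {Q} Q? (x∉L ∷ uniqueL) mem =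
  trans (ℤₚ.pos-+ x (sum L)) (trans (cong (_+_ (+ x)) (sum≡∑-𝟙 L n Q′? uniqueL mem′)) (sym split))
  where
  Q′ : ℕ → Set
  Q′ r = Q r × r ≢ x
  Q′? : ∀ r → Dec (Q′ r)
  Q′? r = Q? r ×-dec ¬? (r ℕ.≟ x)
  mem′ : ∀ r → r ∈ L ⇔ (r ℕ.< n × Q′ r)
  mem′ r = mk⇔ to from
    where
    to : r ∈ L → r ℕ.< n × Q′ r
    to r∈L = let (r<n , q) = Equivalence.to (mem r) (there r∈L) in r<n , q , λ { refl → All.lookup x∉L r∈L refl }
    from : r ℕ.< n × Q′ r → r ∈ L
    from (r<n , q , r≢x) with Equivalence.from (mem r) (r<n , q)
    ... | here r≡x  = ⊥-elim (r≢x r≡x)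
    ... | there r∈L = r∈L
  x<n : x ℕ.< n
  x<n = proj₁ (Equivalence.to (mem x) (here refl))
  Qx : Q x
  Qx = proj₂ (Equivalence.to (mem x) (here refl))
  pointwise : ∀ r → 𝟙 (Q? r) * + r ≡ 𝟙 (r ℕ.≟ x) * + r + 𝟙 (Q′? r) * + r
  pointwise r with Q? r | r ℕ.≟ x
  ... | yes _ | no  _    = sym (ℤₚ.+-identityˡ _)
  ... | yes _ | yes _    = sym (ℤₚ.+-identityʳ _)
  ... | no ¬q | yes refl = ⊥-elim (¬q Qx)
  ... | no _  | no  _    = refl
  split : ∑ n (λ r → 𝟙 (Q? r) * + r) ≡ + x + ∑ n (λ r → 𝟙 (Q′? r) * + r)
  split = trans (∑-cong n (λ r _ → pointwise r))
                (trans (∑-distrib-+ n (λ r → 𝟙 (r ℕ.≟ x) * + r) (λ r → 𝟙 (Q′? r) * + r))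
                       (cong (_+ ∑ n (λ r → 𝟙 (Q′? r) * + r)) (∑-𝟙-≡ n x (λ r → + r) x<n)))

module _ where
  private
    module S = RawSemiring ℤ.+-*-rawSemiring
    module M = RawMonoid ℤ.+-0-rawMonoid

    ^-≡ : ∀ x n → x S.^ n ≡ x ^ n
    ^-≡ x zero    = refl
    ^-≡ x (suc n) = cong (x *_) (^-≡ x n)

    ×-≡ : ∀ n x → n M.× x ≡ + n * x
    ×-≡ zero    x = sym (ℤₚ.*-zeroˡ x)
    ×-≡ (suc n) x = trans (cong (_+_ x) (×-≡ n x)) (lemma x (+ n))
      where
      lemma : ∀ x n → x + n * x ≡ (1ℤ + n) * x
      lemma = solve-∀

    sum-≡ : ∀ n (g : ℕ → ℤ) → M.sum {n} (λ i → g (toℕ i)) ≡ ∑ n g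
    sum-≡ zero    g = refl
    sum-≡ (suc n) g = cong (_+_ (g 0)) (sum-≡ n (λ i → g (suc i)))

  binomial-theorem : ∀ x y n → (x + y) ^ n ≡ ∑ (suc n) (λ k → + (n C k) * (x ^ k * y ^ (n ∸ k)))
  binomial-theorem x y n =
    trans (sym (^-≡ (x + y) n))
    (trans (Binomial.theorem ℤₚ.+-*-semiring x y (ℤₚ.*-comm x y) n)
    (trans (sum-≡ (suc n) (λ k → (n C k) M.× (x S.^ k * y S.^ (n ∸ k))))
           (∑-cong (suc n) (λ k _ → trans (×-≡ (n C k) _)
                                          (cong (+ (n C k) *_) (cong₂ _*_ (^-≡ x k) (^-≡ y (n ∸ k))))))))

[k+1]*[n+1]C[k+1]≡[n+1]*nCk : ∀ n k → suc k ℕ.* (suc n C suc k) ≡ suc n ℕ.* (n C k)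
[k+1]*[n+1]C[k+1]≡[n+1]*nCk zero zero = refl
[k+1]*[n+1]C[k+1]≡[n+1]*nCk zero (suc k) =
  trans (cong (suc (suc k) ℕ.*_) (k>n⇒nCk≡0 {1} {suc (suc k)} (s≤s (s≤s z≤n)))) (ℕₚ.*-zeroʳ (suc (suc k)))
[k+1]*[n+1]C[k+1]≡[n+1]*nCk (suc n) zero =
  trans (ℕₚ.+-identityʳ _) (trans (nC1≡n (suc (suc n))) (sym (ℕₚ.*-identityʳ (suc (suc n)))))
[k+1]*[n+1]C[k+1]≡[n+1]*nCk (suc n) (suc k) = begin
    suc (suc k) ℕ.* (suc (suc n) C suc (suc k))
  ≡⟨ cong (suc (suc k) ℕ.*_) (sym (nCk+nC[k+1]≡[n+1]C[k+1] (suc n) (suc k))) ⟩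
    suc (suc k) ℕ.* (A ℕ.+ B)
  ≡⟨ split k A B ⟩
    suc k ℕ.* A ℕ.+ A ℕ.+ suc (suc k) ℕ.* B
  ≡⟨ cong₂ (λ u v → u ℕ.+ A ℕ.+ v) ([k+1]*[n+1]C[k+1]≡[n+1]*nCk n k) ([k+1]*[n+1]C[k+1]≡[n+1]*nCk n (suc k)) ⟩
    suc n ℕ.* (n C k) ℕ.+ A ℕ.+ suc n ℕ.* (n C suc k)
  ≡⟨ regroup n (n C k) (n C suc k) A ⟩
    suc n ℕ.* (n C k ℕ.+ n C suc k) ℕ.+ A
  ≡⟨ cong (λ u → suc n ℕ.* u ℕ.+ A) (nCk+nC[k+1]≡[n+1]C[k+1] n k) ⟩
    suc n ℕ.* A ℕ.+ A
  ≡⟨ ℕₚ.+-comm (suc n ℕ.* A) A ⟩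
    suc (suc n) ℕ.* A
  ∎
  where
  open ≡-Reasoning
  A = suc n C suc k
  B = suc n C suc (suc k)
  split : ∀ k A B → suc (suc k) ℕ.* (A ℕ.+ B) ≡ suc k ℕ.* A ℕ.+ A ℕ.+ suc (suc k) ℕ.* B
  split = solve-ℕ
  regroup : ∀ n a b A → suc n ℕ.* a ℕ.+ A ℕ.+ suc n ℕ.* b ≡ suc n ℕ.* (a ℕ.+ b) ℕ.+ A
  regroup = solve-ℕ

prime∣pCk : ∀ {p} → Prime p → ∀ k → 0 ℕ.< k → k ℕ.< p → p ∣ℕ (p C k)
prime∣pCk {suc n} p-prime (suc k) _ k<p
  with euclidsLemma (suc k) (suc n C suc k) p-prime
         (ℕ∣.divides (n C k) (trans ([k+1]*[n+1]C[k+1]≡[n+1]*nCk n k) (ℕₚ.*-comm (suc n) (n C k))))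
... | inj₂ p∣pCk = p∣pCk
... | inj₁ p∣k+1 = ⊥-elim (ℕₚ.<⇒≱ k<p (ℕ∣.∣⇒≤ p∣k+1))

module Congruence (p : ℕ) where

  infix 4 _≈_
  record _≈_ (x y : ℤ) : Set where
    constructor mk≈
    field p∣x-y : + p ∣ₛ (x - y)
  open _≈_ public

  ≈-by : ∀ {x y} k → x - y ≡ k * + p → x ≈ y
  ≈-by k eq = mk≈ (divides k eq)

  ≈-refl : ∀ {x} → x ≈ x
  ≈-refl {x} = ≈-by 0ℤ (ℤₚ.+-inverseʳ x)

  ≡⇒≈ : ∀ {x y} → x ≡ y → x ≈ y
  ≡⇒≈ refl = ≈-refl

  ≈-sym : ∀ {x y} → x ≈ y → y ≈ x
  ≈-sym {x} {y} (mk≈ (divides k eq)) =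
    ≈-by (- k) (trans (lemma x y) (trans (cong -_ eq) (ℤₚ.neg-distribˡ-* k (+ p))))
    where
    lemma : ∀ x y → y - x ≡ - (x - y)
    lemma = solve-∀

  ≈-trans : ∀ {x y z} → x ≈ y → y ≈ z → x ≈ z
  ≈-trans {x} {y} {z} (mk≈ (divides k eq)) (mk≈ (divides l eq′)) =
    ≈-by (k + l) (trans (lemma x y z) (trans (cong₂ _+_ eq eq′) (sym (ℤₚ.*-distribʳ-+ (+ p) k l))))
    where
    lemma : ∀ x y z → x - z ≡ (x - y) + (y - z)
    lemma = solve-∀

  ≈-setoid : Setoid _ _
  ≈-setoid = record
    { Carrier       = ℤ
    ; _≈_           = _≈_
    ; isEquivalence = record { refl = ≈-refl ; sym = ≈-sym ; trans = ≈-trans }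
    }

  +-cong : ∀ {a b c d} → a ≈ b → c ≈ d → a + c ≈ b + d
  +-cong {a} {b} {c} {d} (mk≈ (divides k eq)) (mk≈ (divides l eq′)) =
    ≈-by (k + l) (trans (lemma a b c d) (trans (cong₂ _+_ eq eq′) (sym (ℤₚ.*-distribʳ-+ (+ p) k l))))
    where
    lemma : ∀ a b c d → a + c - (b + d) ≡ (a - b) + (c - d)
    lemma = solve-∀

  +-congˡ : ∀ a {c d} → c ≈ d → a + c ≈ a + d
  +-congˡ a = +-cong (≈-refl {a})

  +-congʳ : ∀ c {a b} → a ≈ b → a + c ≈ b + c
  +-congʳ c a≈b = +-cong a≈b (≈-refl {c})

  neg-cong : ∀ {a b} → a ≈ b → - a ≈ - b
  neg-cong {a} {b} (mk≈ (divides k eq)) =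
    ≈-by (- k) (trans (lemma a b) (trans (cong -_ eq) (ℤₚ.neg-distribˡ-* k (+ p))))
    where
    lemma : ∀ a b → - a - - b ≡ - (a - b)
    lemma = solve-∀

  minus-cong : ∀ {a b c d} → a ≈ b → c ≈ d → a - c ≈ b - d
  minus-cong a≈b c≈d = +-cong a≈b (neg-cong c≈d)

  minus-congˡ : ∀ a {c d} → c ≈ d → a - c ≈ a - d
  minus-congˡ a c≈d = minus-cong (≈-refl {a}) c≈d

  minus-congʳ : ∀ c {a b} → a ≈ b → a - c ≈ b - c
  minus-congʳ c a≈b = minus-cong a≈b (≈-refl {c})

  *-congˡ : ∀ c {a b} → a ≈ b → c * a ≈ c * b
  *-congˡ c {a} {b} (mk≈ (divides k eq)) =
    ≈-by (c * k) (trans (lemma c a b) (trans (cong (c *_) eq) (sym (ℤₚ.*-assoc c k (+ p)))))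
    where
    lemma : ∀ c a b → c * a - c * b ≡ c * (a - b)
    lemma = solve-∀

  *-congʳ : ∀ c {a b} → a ≈ b → a * c ≈ b * c
  *-congʳ c {a} {b} a≈b = subst₂ _≈_ (ℤₚ.*-comm c a) (ℤₚ.*-comm c b) (*-congˡ c a≈b)

  *-cong : ∀ {a b c d} → a ≈ b → c ≈ d → a * c ≈ b * d
  *-cong {b = b} {c = c} a≈b c≈d = ≈-trans (*-congʳ c a≈b) (*-congˡ b c≈d)

  ^-cong : ∀ {a b} n → a ≈ b → a ^ n ≈ b ^ n
  ^-cong zero    a≈b = ≈-refl
  ^-cong (suc n) a≈b = *-cong a≈b (^-cong n a≈b)

  ∑-cong≈ : ∀ n {f g : ℕ → ℤ} → (∀ i → i ℕ.< n → f i ≈ g i) → ∑ n f ≈ ∑ n g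
  ∑-cong≈ zero    f≈g = ≈-refl
  ∑-cong≈ (suc n) f≈g = +-cong (f≈g 0 (s≤s z≤n)) (∑-cong≈ n (λ i i<n → f≈g (suc i) (s≤s i<n)))

  p≈0 : + p ≈ 0ℤ
  p≈0 = ≈-by 1ℤ (trans (ℤₚ.+-identityʳ (+ p)) (sym (ℤₚ.*-identityˡ (+ p))))

  k*p≈0 : ∀ k → k * + p ≈ 0ℤ
  k*p≈0 k = ≈-by k (ℤₚ.+-identityʳ (k * + p))

  ∣⇒≈0 : ∀ {x} → + p ∣ₛ x → x ≈ 0ℤ
  ∣⇒≈0 {x} (divides k eq) = ≈-by k (trans (ℤₚ.+-identityʳ x) eq)

  ≈0⇒∣ : ∀ {x} → x ≈ 0ℤ → + p ∣ₛ x
  ≈0⇒∣ {x} (mk≈ (divides k eq)) = divides k (trans (sym (ℤₚ.+-identityʳ x)) eq)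

  x-y≈0⇒x≈y : ∀ {x y} → x - y ≈ 0ℤ → x ≈ y
  x-y≈0⇒x≈y {x} {y} x-y≈0 = mk≈ (subst (+ p ∣ₛ_) (ℤₚ.+-identityʳ (x - y)) (p∣x-y x-y≈0))

  x≈y⇒x-y≈0 : ∀ {x y} → x ≈ y → x - y ≈ 0ℤ
  x≈y⇒x-y≈0 {x} {y} x≈y = mk≈ (subst (+ p ∣ₛ_) (sym (ℤₚ.+-identityʳ (x - y))) (p∣x-y x≈y))

  ∑-support₁ : ∀ n a (f : ℕ → ℤ) → a ℕ.< n → (∀ k → k ℕ.< n → k ≢ a → f k ≈ 0ℤ) → ∑ n f ≈ f a
  ∑-support₁ n a f a<n off≈0 = ≈-trans (∑-cong≈ n f≈𝟙*f) (≡⇒≈ (∑-𝟙-≡ n a f a<n))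
    where
    f≈𝟙*f : ∀ k → k ℕ.< n → f k ≈ 𝟙 (k ℕ.≟ a) * f k
    f≈𝟙*f k k<n with k ℕ.≟ a
    ... | yes _   = ≡⇒≈ (sym (ℤₚ.*-identityˡ (f k)))
    ... | no  k≢a = ≈-trans (off≈0 k k<n k≢a) (≡⇒≈ (sym (ℤₚ.*-zeroˡ (f k))))

  ∑-support₂ : ∀ n a b (f : ℕ → ℤ) → a ℕ.< n → b ℕ.< n → a ≢ b →
               (∀ k → k ℕ.< n → k ≢ a → k ≢ b → f k ≈ 0ℤ) → ∑ n f ≈ f a + f b
  ∑-support₂ n a b f a<n b<n a≢b off≈0 = begin
      ∑ n f
    ≡⟨ ∑-cong n (λ k _ → split (f k) (atB k)) ⟩
      ∑ n (λ k → rest k + atB k)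
    ≡⟨ ∑-distrib-+ n rest atB ⟩
      ∑ n rest + ∑ n atB
    ≈⟨ +-cong (∑-support₁ n a rest a<n rest≈0) (≡⇒≈ (∑-𝟙-≡ n b f b<n)) ⟩
      rest a + f b
    ≈⟨ +-congʳ (f b) rest[a]≈f[a] ⟩
      f a + f b
    ∎
    where
    open SetoidReasoning ≈-setoid
    atB rest : ℕ → ℤ
    atB k = 𝟙 (k ℕ.≟ b) * f k
    rest k = f k - atB k
    split : ∀ x y → x ≡ (x - y) + y
    split = solve-∀
    rest≈0 : ∀ k → k ℕ.< n → k ≢ a → rest k ≈ 0ℤ
    rest≈0 k k<n k≢a with k ℕ.≟ b
    ... | yes refl = ≡⇒≈ (trans (cong (_-_ (f k)) (ℤₚ.*-identityˡ (f k))) (ℤₚ.+-inverseʳ (f k)))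
    ... | no  k≢b  = ≈-trans (≡⇒≈ (trans (cong (_-_ (f k)) (ℤₚ.*-zeroˡ (f k))) (ℤₚ.+-identityʳ (f k))))
                             (off≈0 k k<n k≢a k≢b)
    rest[a]≈f[a] : rest a ≈ f a
    rest[a]≈f[a] with a ℕ.≟ b
    ... | yes a≡b = ⊥-elim (a≢b a≡b)
    ... | no  _   = ≡⇒≈ (trans (cong (_-_ (f a)) (ℤₚ.*-zeroˡ (f a))) (ℤₚ.+-identityʳ (f a)))

  module _ .{{_ : ℕ.NonZero p}} where

    reduce : ℤ → ℕ
    reduce x = x %ℕ p

    reduce<p : ∀ x → reduce x ℕ.< p
    reduce<p x = n%ℕd<d x p

    x≈reduce[x] : ∀ x → x ≈ + reduce x
    x≈reduce[x] x =
      ≈-by (x /ℕ p) (trans (cong (_- + reduce x) (a≡a%ℕn+[a/ℕn]*n x p)) (lemma (+ reduce x) ((x /ℕ p) * + p)))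
      where
      lemma : ∀ a b → a + b - a ≡ b
      lemma = solve-∀

^-distrib-* : ∀ a b n → (a * b) ^ n ≡ a ^ n * b ^ n
^-distrib-* a b zero    = refl
^-distrib-* a b (suc n) = trans (cong ((a * b) *_) (^-distrib-* a b n)) (lemma a b (a ^ n) (b ^ n))
  where
  lemma : ∀ a b c d → a * b * (c * d) ≡ a * c * (b * d)
  lemma = solve-∀

[x*x]^k≡x^[k+k] : ∀ x k → (x * x) ^ k ≡ x ^ (k ℕ.+ k)
[x*x]^k≡x^[k+k] x k = trans (^-distrib-* x x k) (sym (ℤₚ.^-distribˡ-+-* x k k))

-- Real and imaginary parts of iⁿ and of (1 + i)ⁿ, for i² = -1.
re-iⁿ im-iⁿ : ℕ → ℤ
re-iⁿ zero    = 1ℤ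
re-iⁿ (suc k) = - im-iⁿ k
im-iⁿ zero    = 0ℤ
im-iⁿ (suc k) = re-iⁿ k

re-[1+i]ⁿ im-[1+i]ⁿ : ℕ → ℤ
re-[1+i]ⁿ zero    = 1ℤ
re-[1+i]ⁿ (suc n) = re-[1+i]ⁿ n - im-[1+i]ⁿ n
im-[1+i]ⁿ zero    = 0ℤ
im-[1+i]ⁿ (suc n) = re-[1+i]ⁿ n + im-[1+i]ⁿ n

∑-pascal : ∀ n (g : ℕ → ℤ) →
           ∑ (suc (suc n)) (λ k → + (suc n C k) * g k) ≡ ∑ (suc n) (λ k → + (n C k) * (g k + g (suc k)))
∑-pascal n g = begin
    + 1 * g 0 + ∑ (suc n) (λ k → + (suc n C suc k) * g (suc k))
  ≡⟨ cong₂ _+_ (ℤₚ.*-identityˡ (g 0))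
               (∑-cong (suc n) (λ k _ → cong (_* g (suc k))
                 (trans (cong +_ (sym (nCk+nC[k+1]≡[n+1]C[k+1] n k))) (ℤₚ.pos-+ (n C k) (n C suc k))))) ⟩
    g 0 + ∑ (suc n) (λ k → (+ (n C k) + + (n C suc k)) * g (suc k))
  ≡⟨ cong (_+_ (g 0)) (trans (∑-cong (suc n) (λ k _ → ℤₚ.*-distribʳ-+ (g (suc k)) (+ (n C k)) (+ (n C suc k))))
                             (∑-distrib-+ (suc n) (λ k → + (n C k) * g (suc k)) (λ k → + (n C suc k) * g (suc k)))) ⟩
    g 0 + (X + Y)
  ≡⟨ regroup (g 0) X Y ⟩
    (g 0 + Y) + X
  ≡⟨ cong (_+ X) shifted ⟩
    ∑ (suc n) (λ k → + (n C k) * g k) + X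
  ≡⟨ sym (∑-distrib-+ (suc n) (λ k → + (n C k) * g k) (λ k → + (n C k) * g (suc k))) ⟩
    ∑ (suc n) (λ k → + (n C k) * g k + + (n C k) * g (suc k))
  ≡⟨ ∑-cong (suc n) (λ k _ → sym (ℤₚ.*-distribˡ-+ (+ (n C k)) (g k) (g (suc k)))) ⟩
    ∑ (suc n) (λ k → + (n C k) * (g k + g (suc k)))
  ∎
  where
  open ≡-Reasoning
  X = ∑ (suc n) (λ k → + (n C k) * g (suc k))
  Y = ∑ (suc n) (λ k → + (n C suc k) * g (suc k))
  regroup : ∀ a x y → a + (x + y) ≡ (a + y) + x
  regroup = solve-∀
  Y′ = ∑ n (λ k → + (n C suc k) * g (suc k))
  shifted : g 0 + Y ≡ ∑ (suc n) (λ k → + (n C k) * g k)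
  shifted = trans (cong (_+_ (g 0)) (trans (∑-snoc n (λ k → + (n C suc k) * g (suc k)))
                    (trans (cong (λ z → Y′ + + z * g (suc n)) (k>n⇒nCk≡0 (ℕₚ.n<1+n n))) (ℤₚ.+-identityʳ Y′))))
                  (cong (_+ Y′) (sym (ℤₚ.*-identityˡ (g 0))))

[1+i]ⁿ-binomial : ∀ n → re-[1+i]ⁿ n ≡ ∑ (suc n) (λ k → + (n C k) * re-iⁿ k)
                      × im-[1+i]ⁿ n ≡ ∑ (suc n) (λ k → + (n C k) * im-iⁿ k)
[1+i]ⁿ-binomial zero    = refl , refl
[1+i]ⁿ-binomial (suc n) = re-eq , im-eq
  where
  ih = [1+i]ⁿ-binomial n
  re-eq : re-[1+i]ⁿ n - im-[1+i]ⁿ n ≡ ∑ (suc (suc n)) (λ k → + (suc n C k) * re-iⁿ k)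
  re-eq = trans (cong₂ _-_ (proj₁ ih) (proj₂ ih))
          (trans (sym (∑-distrib-minus (suc n) (λ k → + (n C k) * re-iⁿ k) (λ k → + (n C k) * im-iⁿ k)))
          (trans (∑-cong (suc n) (λ k _ → lemma (+ (n C k)) (re-iⁿ k) (im-iⁿ k))) (sym (∑-pascal n re-iⁿ))))
    where
    lemma : ∀ c a b → c * a - c * b ≡ c * (a + - b)
    lemma = solve-∀
  im-eq : re-[1+i]ⁿ n + im-[1+i]ⁿ n ≡ ∑ (suc (suc n)) (λ k → + (suc n C k) * im-iⁿ k)
  im-eq = trans (cong₂ _+_ (proj₁ ih) (proj₂ ih))
          (trans (sym (∑-distrib-+ (suc n) (λ k → + (n C k) * re-iⁿ k) (λ k → + (n C k) * im-iⁿ k)))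
          (trans (∑-cong (suc n) (λ k _ → trans (sym (ℤₚ.*-distribˡ-+ (+ (n C k)) (re-iⁿ k) (im-iⁿ k)))
                                                (cong (+ (n C k) *_) (ℤₚ.+-comm (re-iⁿ k) (im-iⁿ k)))))
                 (sym (∑-pascal n im-iⁿ))))

-- (1 + i)² = 2i
[1+i]^[k+k] : ∀ k → re-[1+i]ⁿ (k ℕ.+ k) ≡ (+ 2) ^ k * re-iⁿ k × im-[1+i]ⁿ (k ℕ.+ k) ≡ (+ 2) ^ k * im-iⁿ k
[1+i]^[k+k] zero = refl , refl
[1+i]^[k+k] (suc k) rewrite ℕₚ.+-suc k k = re-eq , im-eq
  where
  ih = [1+i]^[k+k] k
  re-eq : re-[1+i]ⁿ (k ℕ.+ k) - im-[1+i]ⁿ (k ℕ.+ k) - (re-[1+i]ⁿ (k ℕ.+ k) + im-[1+i]ⁿ (k ℕ.+ k))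
          ≡ + 2 * (+ 2) ^ k * - im-iⁿ k
  re-eq = trans (cong₂ (λ a b → a - b - (a + b)) (proj₁ ih) (proj₂ ih)) (lemma ((+ 2) ^ k) (re-iⁿ k) (im-iⁿ k))
    where
    lemma : ∀ t r i → t * r - t * i - (t * r + t * i) ≡ + 2 * t * - i
    lemma = solve-∀
  im-eq : re-[1+i]ⁿ (k ℕ.+ k) - im-[1+i]ⁿ (k ℕ.+ k) + (re-[1+i]ⁿ (k ℕ.+ k) + im-[1+i]ⁿ (k ℕ.+ k))
          ≡ + 2 * (+ 2) ^ k * re-iⁿ k
  im-eq = trans (cong₂ (λ a b → a - b + (a + b)) (proj₁ ih) (proj₂ ih)) (lemma ((+ 2) ^ k) (re-iⁿ k) (im-iⁿ k))
    where
    lemma : ∀ t r i → t * r - t * i + (t * r + t * i) ≡ + 2 * t * r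
    lemma = solve-∀

i^[k+k] : ∀ k → re-iⁿ (k ℕ.+ k) ≡ (- 1ℤ) ^ k × im-iⁿ (k ℕ.+ k) ≡ 0ℤ
i^[k+k] zero = refl , refl
i^[k+k] (suc k) rewrite ℕₚ.+-suc k k =
  trans (cong -_ (proj₁ (i^[k+k] k))) (sym (ℤₚ.-1*i≡-i ((- 1ℤ) ^ k))) , cong -_ (proj₂ (i^[k+k] k))

iⁿ-periodic : ∀ q j → re-iⁿ (j ℕ.+ q ℕ.* 4) ≡ re-iⁿ j × im-iⁿ (j ℕ.+ q ℕ.* 4) ≡ im-iⁿ j
iⁿ-periodic zero    j rewrite ℕₚ.+-identityʳ j = refl , refl
iⁿ-periodic (suc q) j rewrite ℕₚ.+-suc j (3 ℕ.+ q ℕ.* 4) | ℕₚ.+-suc j (2 ℕ.+ q ℕ.* 4)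
                            | ℕₚ.+-suc j (1 ℕ.+ q ℕ.* 4) | ℕₚ.+-suc j (q ℕ.* 4) =
  trans (ℤₚ.neg-involutive _) (proj₁ (iⁿ-periodic q j)) , trans (ℤₚ.neg-involutive _) (proj₂ (iⁿ-periodic q j))

[-1]^-periodic : ∀ q j → (- 1ℤ) ^ (j ℕ.+ q ℕ.* 4) ≡ (- 1ℤ) ^ j
[-1]^-periodic zero    j rewrite ℕₚ.+-identityʳ j = refl
[-1]^-periodic (suc q) j rewrite ℕₚ.+-suc j (3 ℕ.+ q ℕ.* 4) | ℕₚ.+-suc j (2 ℕ.+ q ℕ.* 4)
                              | ℕₚ.+-suc j (1 ℕ.+ q ℕ.* 4) | ℕₚ.+-suc j (q ℕ.* 4) =
  trans (lemma ((- 1ℤ) ^ (j ℕ.+ q ℕ.* 4))) ([-1]^-periodic q j)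
  where
  lemma : ∀ x → - 1ℤ * (- 1ℤ * (- 1ℤ * (- 1ℤ * x))) ≡ x
  lemma = solve-∀

j+j≡k+k⇒j≡k : ∀ j k → j ℕ.+ j ≡ k ℕ.+ k → j ≡ k
j+j≡k+k⇒j≡k zero    zero    _  = refl
j+j≡k+k⇒j≡k (suc j) (suc k) eq =
  cong suc (j+j≡k+k⇒j≡k j k (ℕₚ.suc-injective (trans (sym (ℕₚ.+-suc j j)) (trans (ℕₚ.suc-injective eq) (ℕₚ.+-suc k k)))))

module PrimeField (m : ℕ) (prime : Prime (suc (m ℕ.+ m))) where

  p : ℕ
  p = suc (m ℕ.+ m)

  open Congruence p public
  module ≈-Reasoning = SetoidReasoning ≈-setoid

  0<m : 0 ℕ.< m
  0<m = ℕₚ.n≢0⇒n>0 (λ m≡0 → ¬prime[1] (subst (λ n → Prime (suc (n ℕ.+ n))) m≡0 prime))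

  0<m+m : 0 ℕ.< m ℕ.+ m
  0<m+m = ℕₚ.<-≤-trans 0<m (ℕₚ.m≤m+n m m)

  x*y≈0⇒x≈0⊎y≈0 : ∀ x y → x * y ≈ 0ℤ → x ≈ 0ℤ ⊎ y ≈ 0ℤ
  x*y≈0⇒x≈0⊎y≈0 x y xy≈0
    with euclidsLemma ℤ.∣ x ∣ ℤ.∣ y ∣ prime (subst (p ℕ∣.∣_) (ℤₚ.abs-* x y) (∣⇒∣ᵤ (≈0⇒∣ xy≈0)))
  ... | inj₁ p∣x = inj₁ (∣⇒≈0 (∣ᵤ⇒∣ p∣x))
  ... | inj₂ p∣y = inj₂ (∣⇒≈0 (∣ᵤ⇒∣ p∣y))

  *-cancelˡ : ∀ x {a b} → ¬ (x ≈ 0ℤ) → x * a ≈ x * b → a ≈ b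
  *-cancelˡ x {a} {b} x≉0 xa≈xb =
    [ (λ x≈0 → ⊥-elim (x≉0 x≈0)) , x-y≈0⇒x≈y ]′
      (x*y≈0⇒x≈0⊎y≈0 x (a - b) (≈-trans (≡⇒≈ (lemma x a b)) (x≈y⇒x-y≈0 xa≈xb)))
    where
    lemma : ∀ x a b → x * (a - b) ≡ x * a - x * b
    lemma = solve-∀

  p∣n⇒+n≈0 : ∀ {n} → p ∣ℕ n → + n ≈ 0ℤ
  p∣n⇒+n≈0 {n} p∣n = ∣⇒≈0 (∣ᵤ⇒∣ {+ p} {+ n} p∣n)

  n≉0 : ∀ n → 0 ℕ.< n → n ℕ.< p → ¬ (+ n ≈ 0ℤ)
  n≉0 n 0<n n<p n≈0 = ℕₚ.<⇒≱ n<p (ℕ∣.∣⇒≤ ⦃ ℕ.>-nonZero 0<n ⦄ (∣⇒∣ᵤ (≈0⇒∣ n≈0)))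

  ≈0? : ∀ x → Dec (x ≈ 0ℤ)
  ≈0? x with + p ∣? x
  ... | yes p∣x = yes (∣⇒≈0 p∣x)
  ... | no  p∤x = no (λ x≈0 → p∤x (≈0⇒∣ x≈0))

  x≈0⇒x^n≈0 : ∀ {x} n → 0 ℕ.< n → x ≈ 0ℤ → x ^ n ≈ 0ℤ
  x≈0⇒x^n≈0 {x} (suc n) _ x≈0 = ≈-trans (*-congʳ (x ^ n) x≈0) (≡⇒≈ (ℤₚ.*-zeroˡ (x ^ n)))

  ∑-pCk≈ : ∀ (f : ℕ → ℤ) → ∑ (suc p) (λ k → + (p C k) * f k) ≈ f 0 + f p
  ∑-pCk≈ f = begin
      ∑ (suc p) g
    ≡⟨ cong (_+_ (g 0)) (∑-snoc (m ℕ.+ m) (λ k → g (suc k))) ⟩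
      g 0 + (∑ (m ℕ.+ m) (λ k → g (suc k)) + g p)
    ≈⟨ +-congˡ (g 0) (+-congʳ (g p) (∑-cong≈ (m ℕ.+ m) inner≈0)) ⟩
      g 0 + (∑ (m ℕ.+ m) (λ _ → 0ℤ) + g p)
    ≡⟨ cong (λ z → g 0 + (z + g p)) (∑-zero (m ℕ.+ m)) ⟩
      g 0 + (0ℤ + g p)
    ≡⟨ cong₂ (λ u v → u + (0ℤ + v)) (ℤₚ.*-identityˡ (f 0))
             (trans (cong (λ z → + z * f p) (nCn≡1 p)) (ℤₚ.*-identityˡ (f p))) ⟩
      f 0 + (0ℤ + f p)
    ≡⟨ cong (_+_ (f 0)) (ℤₚ.+-identityˡ (f p)) ⟩
      f 0 + f p
    ∎
    where
    open ≈-Reasoning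
    g : ℕ → ℤ
    g k = + (p C k) * f k
    inner≈0 : ∀ i → i ℕ.< m ℕ.+ m → g (suc i) ≈ 0ℤ
    inner≈0 i i<2m with prime∣pCk prime (suc i) (s≤s z≤n) (s≤s i<2m)
    ... | ℕ∣.divides q eq = ≈-trans (≡⇒≈ (trans (cong (λ z → + z * f (suc i)) eq)
                                       (trans (cong (_* f (suc i)) (ℤₚ.pos-* q p)) (lemma (+ q) (+ p) (f (suc i))))))
                                  (k*p≈0 (+ q * f (suc i)))
      where
      lemma : ∀ a b c → a * b * c ≡ a * c * b
      lemma = solve-∀

  fermat-ℕ : ∀ x → (+ x) ^ p ≈ + x
  fermat-ℕ zero    = ≈-refl
  fermat-ℕ (suc x) = begin
      (+ suc x) ^ p
    ≡⟨ cong (_^ p) (ℤₚ.pos-+ 1 x) ⟩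
      (1ℤ + + x) ^ p
    ≡⟨ binomial-theorem 1ℤ (+ x) p ⟩
      ∑ (suc p) (λ k → + (p C k) * (1ℤ ^ k * (+ x) ^ (p ∸ k)))
    ≈⟨ ∑-pCk≈ (λ k → 1ℤ ^ k * (+ x) ^ (p ∸ k)) ⟩
      1ℤ * (+ x) ^ p + 1ℤ ^ p * (+ x) ^ (p ∸ p)
    ≡⟨ cong₂ _+_ (ℤₚ.*-identityˡ ((+ x) ^ p)) (cong₂ (λ a b → a * (+ x) ^ b) (ℤₚ.^-zeroˡ p) (ℕₚ.n∸n≡0 p)) ⟩
      (+ x) ^ p + 1ℤ
    ≈⟨ +-congʳ 1ℤ (fermat-ℕ x) ⟩
      + x + 1ℤ
    ≡⟨ trans (ℤₚ.+-comm (+ x) 1ℤ) (sym (ℤₚ.pos-+ 1 x)) ⟩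
      + suc x
    ∎
    where open ≈-Reasoning

  fermat : ∀ x → x ^ p ≈ x
  fermat x = ≈-trans (^-cong p (x≈reduce[x] x)) (≈-trans (fermat-ℕ (reduce x)) (≈-sym (x≈reduce[x] x)))

  fermat′ : ∀ x → ¬ (x ≈ 0ℤ) → x ^ (m ℕ.+ m) ≈ 1ℤ
  fermat′ x x≉0 = *-cancelˡ x x≉0 (≈-trans (fermat x) (≡⇒≈ (sym (ℤₚ.*-identityʳ x))))

  x^m≈1⊎x^m≈-1 : ∀ x → ¬ (x ≈ 0ℤ) → x ^ m ≈ 1ℤ ⊎ x ^ m ≈ - 1ℤ
  x^m≈1⊎x^m≈-1 x x≉0 =
    Sum.map x-y≈0⇒x≈y x-y≈0⇒x≈y
      (x*y≈0⇒x≈0⊎y≈0 (x ^ m - 1ℤ) (x ^ m + 1ℤ)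
        (≈-trans (≡⇒≈ (trans (lemma (x ^ m)) (cong (_- 1ℤ) (sym (ℤₚ.^-distribˡ-+-* x m m)))))
                 (x≈y⇒x-y≈0 (fermat′ x x≉0))))
    where
    lemma : ∀ a → (a - 1ℤ) * (a + 1ℤ) ≡ a * a - 1ℤ
    lemma = solve-∀

  powerSum : ℕ → ℤ
  powerSum j = ∑ p (λ s → (+ s) ^ j)

  powerSum-0 : powerSum 0 ≈ 0ℤ
  powerSum-0 = ≈-trans (≡⇒≈ (trans (∑-const p 1ℤ) (ℤₚ.*-identityʳ (+ p)))) p≈0

  [s+1]^[j+1]-s^[j+1] : ∀ j s → (+ suc s) ^ suc j - (+ s) ^ suc j ≡ ∑ (suc j) (λ k → + (suc j C k) * (+ s) ^ k)
  [s+1]^[j+1]-s^[j+1] j s = begin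
      (+ suc s) ^ suc j - (+ s) ^ suc j
    ≡⟨ cong (λ z → z ^ suc j - (+ s) ^ suc j) (trans (cong +_ (ℕₚ.+-comm 1 s)) (ℤₚ.pos-+ s 1)) ⟩
      (+ s + 1ℤ) ^ suc j - (+ s) ^ suc j
    ≡⟨ cong (_- (+ s) ^ suc j) (trans (binomial-theorem (+ s) 1ℤ (suc j)) (∑-snoc (suc j) g)) ⟩
      ∑ (suc j) g + g (suc j) - (+ s) ^ suc j
    ≡⟨ cong (λ z → ∑ (suc j) g + z - (+ s) ^ suc j) top ⟩
      ∑ (suc j) g + (+ s) ^ suc j - (+ s) ^ suc j
    ≡⟨ cancel (∑ (suc j) g) ((+ s) ^ suc j) ⟩
      ∑ (suc j) g
    ≡⟨ ∑-cong (suc j) (λ k _ → cong (+ (suc j C k) *_)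
                                    (trans (cong ((+ s) ^ k *_) (ℤₚ.^-zeroˡ (suc j ∸ k))) (ℤₚ.*-identityʳ ((+ s) ^ k)))) ⟩
      ∑ (suc j) (λ k → + (suc j C k) * (+ s) ^ k)
    ∎
    where
    open ≡-Reasoning
    g : ℕ → ℤ
    g k = + (suc j C k) * ((+ s) ^ k * 1ℤ ^ (suc j ∸ k))
    top : g (suc j) ≡ (+ s) ^ suc j
    top = trans (cong (λ z → + z * ((+ s) ^ suc j * 1ℤ ^ (suc j ∸ suc j))) (nCn≡1 (suc j)))
                (trans (ℤₚ.*-identityˡ _)
                       (trans (cong (λ z → (+ s) ^ suc j * 1ℤ ^ z) (ℕₚ.n∸n≡0 j)) (ℤₚ.*-identityʳ _)))
    cancel : ∀ a b → a + b - b ≡ a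
    cancel = solve-∀

  -- Summing the previous identity over s telescopes.
  ∑-[j+1]Ck*powerSum : ∀ j → ∑ (suc j) (λ k → + (suc j C k) * powerSum k) ≡ (+ p) ^ suc j
  ∑-[j+1]Ck*powerSum j = begin
      ∑ (suc j) (λ k → coeff k * powerSum k)
    ≡⟨ ∑-cong (suc j) (λ k _ → sym (∑-*ˡ p (coeff k) (λ s → (+ s) ^ k))) ⟩
      ∑ (suc j) (λ k → ∑ p (λ s → coeff k * (+ s) ^ k))
    ≡⟨ ∑-comm (suc j) p (λ k s → coeff k * (+ s) ^ k) ⟩
      ∑ p (λ s → ∑ (suc j) (λ k → coeff k * (+ s) ^ k))
    ≡⟨ ∑-cong p (λ s _ → sym ([s+1]^[j+1]-s^[j+1] j s)) ⟩
      ∑ p (λ s → (+ suc s) ^ suc j - (+ s) ^ suc j)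
    ≡⟨ ∑-telescope p (λ s → (+ s) ^ suc j) ⟩
      (+ p) ^ suc j - 0ℤ
    ≡⟨ ℤₚ.+-identityʳ ((+ p) ^ suc j) ⟩
      (+ p) ^ suc j
    ∎
    where
    open ≡-Reasoning
    coeff : ℕ → ℤ
    coeff k = + (suc j C k)

  [j+1]Cj≡j+1 : ∀ j → suc j C j ≡ suc j
  [j+1]Cj≡j+1 j = trans (nCk≡nC[n∸k] {j} {suc j} (ℕₚ.n≤1+n j))
                        (trans (cong (suc j C_) (ℕₚ.m+n∸n≡m 1 j)) (nC1≡n (suc j)))

  -- Induction on j: in the identity above all lower power sums vanish and p^(j+1) ≈ 0,
  -- leaving (j+1) · powerSum j ≈ 0 with j + 1 invertible.
  powerSum≈0 : ∀ j → 0 ℕ.< j → j ℕ.< m ℕ.+ m → powerSum j ≈ 0ℤ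
  powerSum≈0 = <-rec (λ j → 0 ℕ.< j → j ℕ.< m ℕ.+ m → powerSum j ≈ 0ℤ) step
    where
    step : ∀ j → (∀ {k} → k ℕ.< j → 0 ℕ.< k → k ℕ.< m ℕ.+ m → powerSum k ≈ 0ℤ) →
           0 ℕ.< j → j ℕ.< m ℕ.+ m → powerSum j ≈ 0ℤ
    step j rec _ j<2m = *-cancelˡ (+ suc j) (n≉0 (suc j) (s≤s z≤n) (s≤s j<2m)) (begin
        + suc j * powerSum j
      ≈⟨ ≈-sym (≈-trans (+-congʳ (+ suc j * powerSum j) lower≈0) (≡⇒≈ (ℤₚ.+-identityˡ _))) ⟩
        lower + + suc j * powerSum j
      ≡⟨ cong (λ z → lower + + z * powerSum j) (sym ([j+1]Cj≡j+1 j)) ⟩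
        lower + coeff j * powerSum j
      ≡⟨ sym (∑-snoc j (λ k → coeff k * powerSum k)) ⟩
        ∑ (suc j) (λ k → coeff k * powerSum k)
      ≡⟨ ∑-[j+1]Ck*powerSum j ⟩
        (+ p) ^ suc j
      ≈⟨ x≈0⇒x^n≈0 (suc j) (s≤s z≤n) p≈0 ⟩
        0ℤ
      ≡⟨ sym (ℤₚ.*-zeroʳ (+ suc j)) ⟩
        + suc j * 0ℤ
      ∎)
      where
      open ≈-Reasoning
      coeff : ℕ → ℤ
      coeff k = + (suc j C k)
      lower = ∑ j (λ k → coeff k * powerSum k)
      term≈0 : ∀ k → k ℕ.< j → coeff k * powerSum k ≈ 0ℤ
      term≈0 zero    _   = ≈-trans (*-congˡ (coeff 0) powerSum-0) (≡⇒≈ (ℤₚ.*-zeroʳ (coeff 0)))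
      term≈0 (suc k) k<j = ≈-trans (*-congˡ (coeff (suc k)) (rec k<j (s≤s z≤n) (ℕₚ.<-trans k<j j<2m)))
                                   (≡⇒≈ (ℤₚ.*-zeroʳ (coeff (suc k))))
      lower≈0 : lower ≈ 0ℤ
      lower≈0 = ≈-trans (∑-cong≈ j term≈0) (≡⇒≈ (∑-zero j))

  x^[j+p-1]≈x^j : ∀ x j → 0 ℕ.< j → x ^ (j ℕ.+ (m ℕ.+ m)) ≈ x ^ j
  x^[j+p-1]≈x^j x (suc j) _ with ≈0? x
  ... | yes x≈0 = ≈-trans (x≈0⇒x^n≈0 (suc (j ℕ.+ (m ℕ.+ m))) (s≤s z≤n) x≈0) (≈-sym (x≈0⇒x^n≈0 (suc j) (s≤s z≤n) x≈0))
  ... | no  x≉0 = ≈-trans (≡⇒≈ (ℤₚ.^-distribˡ-+-* x (suc j) (m ℕ.+ m)))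
                          (≈-trans (*-congˡ (x ^ suc j) (fermat′ x x≉0)) (≡⇒≈ (ℤₚ.*-identityʳ _)))

  powerSum-periodic : ∀ j → 0 ℕ.< j → powerSum (j ℕ.+ (m ℕ.+ m)) ≈ powerSum j
  powerSum-periodic j 0<j = ∑-cong≈ p (λ s _ → x^[j+p-1]≈x^j (+ s) j 0<j)

  powerSum[p-1]≈-1 : powerSum (m ℕ.+ m) ≈ - 1ℤ
  powerSum[p-1]≈-1 = begin
      0ℤ ^ (m ℕ.+ m) + ∑ (m ℕ.+ m) (λ s → (+ suc s) ^ (m ℕ.+ m))
    ≈⟨ +-congʳ (∑ (m ℕ.+ m) (λ s → (+ suc s) ^ (m ℕ.+ m))) (x≈0⇒x^n≈0 (m ℕ.+ m) 0<m+m ≈-refl) ⟩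
      0ℤ + ∑ (m ℕ.+ m) (λ s → (+ suc s) ^ (m ℕ.+ m))
    ≈⟨ +-congˡ 0ℤ (∑-cong≈ (m ℕ.+ m) (λ s s<2m → fermat′ (+ suc s) (n≉0 (suc s) (s≤s z≤n) (s≤s s<2m)))) ⟩
      0ℤ + ∑ (m ℕ.+ m) (λ _ → 1ℤ)
    ≡⟨ trans (ℤₚ.+-identityˡ _) (trans (∑-const (m ℕ.+ m) 1ℤ) (ℤₚ.*-identityʳ (+ (m ℕ.+ m)))) ⟩
      + (m ℕ.+ m)
    ≈⟨ ≈-by 1ℤ (trans (ℤₚ.+-comm (+ (m ℕ.+ m)) 1ℤ) (sym (ℤₚ.*-identityˡ (+ p)))) ⟩
      - 1ℤ
    ∎
    where open ≈-Reasoning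

  [p-1]Ck≈[-1]^k : ∀ k → k ℕ.≤ m ℕ.+ m → + ((m ℕ.+ m) C k) ≈ (- 1ℤ) ^ k
  [p-1]Ck≈[-1]^k zero    _    = ≈-refl
  [p-1]Ck≈[-1]^k (suc k) k<2m =
    ≈-trans (≡⇒≈ pascal)
            (≈-trans (minus-cong (p∣n⇒+n≈0 (prime∣pCk prime (suc k) (s≤s z≤n) (s≤s k<2m)))
                                 ([p-1]Ck≈[-1]^k k (ℕₚ.<⇒≤ k<2m)))
                     (≡⇒≈ (lemma ((- 1ℤ) ^ k))))
    where
    n = m ℕ.+ m
    pascal : + (n C suc k) ≡ + (p C suc k) - + (n C k)
    pascal = trans (cancel (+ (n C k)) (+ (n C suc k)))
                   (cong (_- + (n C k)) (trans (sym (ℤₚ.pos-+ (n C k) (n C suc k)))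
                                               (cong +_ (nCk+nC[k+1]≡[n+1]C[k+1] n k))))
      where
      cancel : ∀ a b → b ≡ a + b - a
      cancel = solve-∀
    lemma : ∀ x → 0ℤ - x ≡ - 1ℤ * x
    lemma = solve-∀

  𝟙[x≈0]≈1-x^[p-1] : ∀ x → 𝟙 (≈0? x) ≈ 1ℤ - x ^ (m ℕ.+ m)
  𝟙[x≈0]≈1-x^[p-1] x with ≈0? x
  ... | yes x≈0 = ≈-sym (minus-cong (≈-refl {1ℤ}) (x≈0⇒x^n≈0 (m ℕ.+ m) 0<m+m x≈0))
  ... | no  x≉0 = ≈-sym (≈-trans (minus-cong (≈-refl {1ℤ}) (fermat′ x x≉0)) (≡⇒≈ (ℤₚ.+-inverseʳ 1ℤ)))

  rootCount : ℤ → ℤ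
  rootCount z = ∑ p (λ x → 𝟙 (≈0? ((+ x) * (+ x) - z)))

  powerSum[k+k]≈0 : ∀ k → k ℕ.< suc (m ℕ.+ m) → k ≢ m → k ≢ m ℕ.+ m → powerSum (k ℕ.+ k) ≈ 0ℤ
  powerSum[k+k]≈0 k k<2m+1 k≢m k≢2m with ℕₚ.<-cmp k m
  ... | tri≈ _ k≡m _ = ⊥-elim (k≢m k≡m)
  ... | tri< k<m _ _ = below k k<m
    where
    below : ∀ k → k ℕ.< m → powerSum (k ℕ.+ k) ≈ 0ℤ
    below zero    _   = powerSum-0
    below (suc k) k<m = powerSum≈0 (suc k ℕ.+ suc k) (s≤s z≤n) (ℕₚ.+-mono-< k<m k<m)
  ... | tri> _ _ m<k =
    ≈-trans (≡⇒≈ (cong powerSum k+k≡t+t+2m))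
            (≈-trans (powerSum-periodic (t ℕ.+ t) 0<t+t) (powerSum≈0 (t ℕ.+ t) 0<t+t (ℕₚ.+-mono-< t<m t<m)))
    where
    t = k ∸ m
    m+t≡k : m ℕ.+ t ≡ k
    m+t≡k = ℕₚ.m+[n∸m]≡n (ℕₚ.<⇒≤ m<k)
    k+k≡t+t+2m : k ℕ.+ k ≡ (t ℕ.+ t) ℕ.+ (m ℕ.+ m)
    k+k≡t+t+2m = trans (cong₂ ℕ._+_ (sym m+t≡k) (sym m+t≡k)) (regroup m t)
      where
      regroup : ∀ m t → (m ℕ.+ t) ℕ.+ (m ℕ.+ t) ≡ (t ℕ.+ t) ℕ.+ (m ℕ.+ m)
      regroup = solve-ℕ
    0<t+t : 0 ℕ.< t ℕ.+ t
    0<t+t = ℕₚ.<-≤-trans (ℕₚ.m<n⇒0<n∸m m<k) (ℕₚ.m≤m+n t t)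
    t<m : t ℕ.< m
    t<m = ℕₚ.+-cancelˡ-< m t m (subst (ℕ._< m ℕ.+ m) (sym m+t≡k) (ℕₚ.≤∧≢⇒< (ℕₚ.≤-pred k<2m+1) k≢2m))

  -- Expanding binomially, only the power sums of exponent 2m and 4m survive.
  ∑[x²-z]^[p-1]≈-1-z^m : ∀ z → ∑ p (λ x → ((+ x) * (+ x) - z) ^ (m ℕ.+ m)) ≈ - 1ℤ - z ^ m
  ∑[x²-z]^[p-1]≈-1-z^m z = begin
      ∑ p (λ x → ((+ x) * (+ x) - z) ^ n)
    ≡⟨ expand ⟩
      ∑ (suc n) term
    ≈⟨ ∑-support₂ (suc n) m n term (s≤s (ℕₚ.m≤m+n m m)) ℕₚ.≤-refl (ℕₚ.<⇒≢ (ℕₚ.m<m+n m 0<m)) off≈0 ⟩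
      term m + term n
    ≈⟨ +-cong term[m] term[n] ⟩
      (- 1ℤ) ^ m * ((- z) ^ m * - 1ℤ) + 1ℤ * (1ℤ * - 1ℤ)
    ≡⟨ simplify ((- 1ℤ) ^ m) ((- z) ^ m) ⟩
      - 1ℤ - (- 1ℤ) ^ m * (- z) ^ m
    ≡⟨ cong (λ u → - 1ℤ - u) (sym (^-distrib-* (- 1ℤ) (- z) m)) ⟩
      - 1ℤ - (- 1ℤ * - z) ^ m
    ≡⟨ cong (λ u → - 1ℤ - u ^ m) (trans (ℤₚ.-1*i≡-i (- z)) (ℤₚ.neg-involutive z)) ⟩
      - 1ℤ - z ^ m
    ∎
    where
    open ≈-Reasoning
    n = m ℕ.+ m
    coeff : ℕ → ℤ
    coeff k = + (n C k)
    term : ℕ → ℤ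
    term k = coeff k * ((- z) ^ (n ∸ k) * powerSum (k ℕ.+ k))
    expand : ∑ p (λ x → ((+ x) * (+ x) - z) ^ n) ≡ ∑ (suc n) term
    expand = trans (∑-cong p (λ x _ → binomial-theorem ((+ x) * (+ x)) (- z) n))
             (trans (∑-comm p (suc n) (λ x k → coeff k * (((+ x) * (+ x)) ^ k * (- z) ^ (n ∸ k))))
             (∑-cong (suc n) (λ k _ →
               trans (∑-cong p (λ x _ → cong (coeff k *_) (trans (ℤₚ.*-comm _ ((- z) ^ (n ∸ k)))
                                                                  (cong ((- z) ^ (n ∸ k) *_) ([x*x]^k≡x^[k+k] (+ x) k)))))
               (trans (∑-*ˡ p (coeff k) (λ x → (- z) ^ (n ∸ k) * (+ x) ^ (k ℕ.+ k)))
                      (cong (coeff k *_) (∑-*ˡ p ((- z) ^ (n ∸ k)) (λ x → (+ x) ^ (k ℕ.+ k))))))))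
    off≈0 : ∀ k → k ℕ.< suc n → k ≢ m → k ≢ n → term k ≈ 0ℤ
    off≈0 k k<n+1 k≢m k≢n =
      ≈-trans (*-congˡ (coeff k) (*-congˡ ((- z) ^ (n ∸ k)) (powerSum[k+k]≈0 k k<n+1 k≢m k≢n)))
              (≡⇒≈ (trans (cong (coeff k *_) (ℤₚ.*-zeroʳ ((- z) ^ (n ∸ k)))) (ℤₚ.*-zeroʳ (coeff k))))
    term[m] : term m ≈ (- 1ℤ) ^ m * ((- z) ^ m * - 1ℤ)
    term[m] = *-cong ([p-1]Ck≈[-1]^k m (ℕₚ.m≤m+n m m))
                     (*-cong (≡⇒≈ (cong ((- z) ^_) (ℕₚ.m+n∸m≡n m m))) powerSum[p-1]≈-1)
    term[n] : term n ≈ 1ℤ * (1ℤ * - 1ℤ)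
    term[n] = *-cong (≡⇒≈ (cong +_ (nCn≡1 n)))
                     (*-cong (≡⇒≈ (cong ((- z) ^_) (ℕₚ.n∸n≡0 n)))
                             (≈-trans (powerSum-periodic n 0<m+m) powerSum[p-1]≈-1))
    simplify : ∀ a b → a * (b * - 1ℤ) + 1ℤ * (1ℤ * - 1ℤ) ≡ - 1ℤ - a * b
    simplify = solve-∀

  -- 𝟙[x² ≈ z] ≈ 1 − (x² − z)^(p−1)
  rootCount≈1+z^m : ∀ z → rootCount z ≈ 1ℤ + z ^ m
  rootCount≈1+z^m z = begin
      rootCount z
    ≈⟨ ∑-cong≈ p (λ x _ → 𝟙[x≈0]≈1-x^[p-1] ((+ x) * (+ x) - z)) ⟩
      ∑ p (λ x → 1ℤ - ((+ x) * (+ x) - z) ^ (m ℕ.+ m))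
    ≡⟨ ∑-distrib-minus p (λ _ → 1ℤ) (λ x → ((+ x) * (+ x) - z) ^ (m ℕ.+ m)) ⟩
      ∑ p (λ _ → 1ℤ) - ∑ p (λ x → ((+ x) * (+ x) - z) ^ (m ℕ.+ m))
    ≈⟨ minus-cong powerSum-0 (∑[x²-z]^[p-1]≈-1-z^m z) ⟩
      0ℤ - (- 1ℤ - z ^ m)
    ≡⟨ simplify (z ^ m) ⟩
      1ℤ + z ^ m
    ∎
    where
    open ≈-Reasoning
    simplify : ∀ a → 0ℤ - (- 1ℤ - a) ≡ 1ℤ + a
    simplify = solve-∀

  IsSquare : ℤ → Set
  IsSquare z = ∃ λ x → x * x - z ≈ 0ℤ

  IsSquare-resp : ∀ {x y} → x ≈ y → IsSquare x → IsSquare y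
  IsSquare-resp x≈y (u , u²≈x) = u , ≈-trans (minus-cong (≈-refl {u * u}) (≈-sym x≈y)) u²≈x

  2<p : 2 ℕ.< p
  2<p = s≤s (ℕₚ.+-mono-≤ 0<m 0<m)

  z^m≈1⇒IsSquare : ∀ z → z ^ m ≈ 1ℤ → IsSquare z
  z^m≈1⇒IsSquare z z^m≈1 with ℕₚ.anyUpTo? (λ x → ≈0? ((+ x) * (+ x) - z)) p
  ... | yes (x , _ , x²≈z) = + x , x²≈z
  ... | no  noRoot         = ⊥-elim (n≉0 2 (s≤s z≤n) 2<p (begin
      + 2
    ≈⟨ ≈-sym (+-congˡ 1ℤ z^m≈1) ⟩
      1ℤ + z ^ m
    ≈⟨ ≈-sym (rootCount≈1+z^m z) ⟩
      rootCount z
    ≡⟨ trans (∑-cong p (λ x x<p → 𝟙-no (≈0? _) (λ x²≈z → noRoot (x , x<p , x²≈z)))) (∑-zero p) ⟩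
      0ℤ
    ∎))
    where open ≈-Reasoning

  IsSquare⇒z^m≈1 : ∀ z → IsSquare z → ¬ (z ≈ 0ℤ) → z ^ m ≈ 1ℤ
  IsSquare⇒z^m≈1 z (x , x²-z≈0) z≉0 =
    ≈-trans (^-cong m (≈-sym x²≈z)) (≈-trans (≡⇒≈ ([x*x]^k≡x^[k+k] x m)) (fermat′ x x≉0))
    where
    x²≈z = x-y≈0⇒x≈y x²-z≈0
    x≉0 : ¬ (x ≈ 0ℤ)
    x≉0 x≈0 = z≉0 (≈-trans (≈-sym x²≈z) (≈-trans (*-congʳ x x≈0) (≡⇒≈ (ℤₚ.*-zeroˡ x))))

  IsSquare? : ∀ z → Dec (IsSquare z)
  IsSquare? z with ≈0? z
  ... | yes z≈0 = yes (0ℤ , ≈-trans (≡⇒≈ (ℤₚ.+-identityˡ (- z))) (neg-cong z≈0))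
  ... | no  z≉0 with ≈0? (z ^ m - 1ℤ)
  ...   | yes z^m-1≈0 = yes (z^m≈1⇒IsSquare z (x-y≈0⇒x≈y z^m-1≈0))
  ...   | no  z^m≉1   = no (λ sq → z^m≉1 (x≈y⇒x-y≈0 (IsSquare⇒z^m≈1 z sq z≉0)))

  2*𝟙[IsSquare]≈1+z^m+𝟙[z≈0] : ∀ z → + 2 * 𝟙 (IsSquare? z) ≈ 1ℤ + z ^ m + 𝟙 (≈0? z)
  2*𝟙[IsSquare]≈1+z^m+𝟙[z≈0] z = by-cases (IsSquare? z) (≈0? z)
    where
    by-cases : (sq? : Dec (IsSquare z)) (z≈0? : Dec (z ≈ 0ℤ)) → + 2 * 𝟙 sq? ≈ 1ℤ + z ^ m + 𝟙 z≈0?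
    by-cases (yes _)  (yes z≈0) = ≈-sym (+-congʳ 1ℤ (+-congˡ 1ℤ (x≈0⇒x^n≈0 m 0<m z≈0)))
    by-cases (no ¬sq) (yes z≈0) = ⊥-elim (¬sq (0ℤ , ≈-trans (≡⇒≈ (ℤₚ.+-identityˡ (- z))) (neg-cong z≈0)))
    by-cases (yes sq) (no z≉0)  = ≈-sym (+-congʳ 0ℤ (+-congˡ 1ℤ (IsSquare⇒z^m≈1 z sq z≉0)))
    by-cases (no ¬sq) (no z≉0) =
      [ (λ z^m≈1 → ⊥-elim (¬sq (z^m≈1⇒IsSquare z z^m≈1))) , (λ z^m≈-1 → ≈-sym (+-congʳ 0ℤ (+-congˡ 1ℤ z^m≈-1))) ]′
        (x^m≈1⊎x^m≈-1 z z≉0)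

  -- (1 + i)^p ≈ 1 + i^p = 1 - i, while (1 + i)^p = (1 + i)(2i)^m.
  re-[1+i]^p≈1 : re-[1+i]ⁿ p ≈ 1ℤ
  re-[1+i]^p≈1 = ≈-trans (≡⇒≈ (proj₁ ([1+i]ⁿ-binomial p)))
                         (≈-trans (∑-pCk≈ re-iⁿ) (≡⇒≈ (cong (λ z → 1ℤ + - z) (proj₂ (i^[k+k] m)))))

  2^m*[re-im]≈1 : (+ 2) ^ m * (re-iⁿ m - im-iⁿ m) ≈ 1ℤ
  2^m*[re-im]≈1 =
    ≈-trans (≡⇒≈ (trans (ℤₚ.*-distribˡ-+ ((+ 2) ^ m) (re-iⁿ m) (- im-iⁿ m))
                        (trans (cong (_+_ ((+ 2) ^ m * re-iⁿ m)) (sym (ℤₚ.neg-distribʳ-* ((+ 2) ^ m) (im-iⁿ m))))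
                               (sym (cong₂ _-_ (proj₁ ([1+i]^[k+k] m)) (proj₂ ([1+i]^[k+k] m)))))))
            re-[1+i]^p≈1

  p≡1+2m : + p ≡ 1ℤ + (+ m + + m)
  p≡1+2m = trans (ℤₚ.pos-+ 1 (m ℕ.+ m)) (cong (_+_ 1ℤ) (ℤₚ.pos-+ m m))

  ½ : ℤ
  ½ = 1ℤ + + m

  2*½≈1 : + 2 * ½ ≈ 1ℤ
  2*½≈1 = ≈-by 1ℤ (trans (lemma (+ m)) (sym (trans (ℤₚ.*-identityˡ (+ p)) p≡1+2m)))
    where
    lemma : ∀ M → + 2 * (1ℤ + M) - 1ℤ ≡ 1ℤ + (M + M)
    lemma = solve-∀

  ½^m≈re-im : ½ ^ m ≈ re-iⁿ m - im-iⁿ m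
  ½^m≈re-im = begin
      ½ ^ m
    ≡⟨ sym (ℤₚ.*-identityʳ (½ ^ m)) ⟩
      ½ ^ m * 1ℤ
    ≈⟨ ≈-sym (*-congˡ (½ ^ m) 2^m*[re-im]≈1) ⟩
      ½ ^ m * ((+ 2) ^ m * σ)
    ≡⟨ trans (sym (ℤₚ.*-assoc (½ ^ m) ((+ 2) ^ m) σ)) (cong (_* σ) (trans (ℤₚ.*-comm (½ ^ m) ((+ 2) ^ m)) (sym (^-distrib-* (+ 2) ½ m)))) ⟩
      (+ 2 * ½) ^ m * σ
    ≈⟨ *-congʳ σ (^-cong m 2*½≈1) ⟩
      1ℤ ^ m * σ
    ≡⟨ trans (cong (_* σ) (ℤₚ.^-zeroˡ m)) (ℤₚ.*-identityˡ σ) ⟩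
      σ
    ∎
    where
    open ≈-Reasoning
    σ = re-iⁿ m - im-iⁿ m

  n≈m⇒n≡m : ∀ a b → a ℕ.< p → b ℕ.< p → + a ≈ + b → a ≡ b
  n≈m⇒n≡m a b a<p b<p a≈b with ℕₚ.<-cmp a b
  ... | tri≈ _ a≡b _ = a≡b
  ... | tri< a<b _ _ = ⊥-elim (n≉0 (b ∸ a) (ℕₚ.m<n⇒0<n∸m a<b) (ℕₚ.≤-<-trans (ℕₚ.m∸n≤m b a) b<p)
                         (≈-trans (≡⇒≈ (sym (+b-+a≡+[b∸a] (ℕₚ.<⇒≤ a<b)))) (x≈y⇒x-y≈0 (≈-sym a≈b))))
    where
    +b-+a≡+[b∸a] : ∀ {a b} → a ℕ.≤ b → + b - + a ≡ + (b ∸ a)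
    +b-+a≡+[b∸a] {a} {b} a≤b = trans (ℤₚ.m-n≡m⊖n b a) (ℤₚ.⊖-≥ a≤b)
  ... | tri> _ _ b<a = ⊥-elim (n≉0 (a ∸ b) (ℕₚ.m<n⇒0<n∸m b<a) (ℕₚ.≤-<-trans (ℕₚ.m∸n≤m a b) a<p)
                         (≈-trans (≡⇒≈ (sym (trans (ℤₚ.m-n≡m⊖n a b) (ℤₚ.⊖-≥ (ℕₚ.<⇒≤ b<a))))) (x≈y⇒x-y≈0 a≈b)))

  ∑-𝟙[w≈d] : ∀ (Φ : ℤ → ℤ) → Φ Preserves _≈_ ⟶ _≈_ → ∀ w → ∑ p (λ d → 𝟙 (≈0? (w - + d)) * Φ (+ d)) ≈ Φ w
  ∑-𝟙[w≈d] Φ Φ-cong w =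
    ≈-trans (≡⇒≈ (trans (∑-cong p (λ d d<p → cong (_* Φ (+ d)) (𝟙-cong (≈0? (w - + d)) (d ℕ.≟ r) (to d d<p) (from d))))
                        (∑-𝟙-≡ p r (λ d → Φ (+ d)) (reduce<p w))))
            (Φ-cong (≈-sym (x≈reduce[x] w)))
    where
    r = reduce w
    to : ∀ d → d ℕ.< p → w - + d ≈ 0ℤ → d ≡ r
    to d d<p w≈d = n≈m⇒n≡m d r d<p (reduce<p w) (≈-trans (≈-sym (x-y≈0⇒x≈y w≈d)) (x≈reduce[x] w))
    from : ∀ d → d ≡ r → w - + d ≈ 0ℤ
    from d refl = x≈y⇒x-y≈0 (x≈reduce[x] w)

  ∑-shift-ℕ : ∀ F → F Preserves _≈_ ⟶ _≈_ → ∀ a → ∑ p (λ r → F (+ r)) ≈ ∑ p (λ r → F (+ r + + a))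
  ∑-shift-ℕ F F-cong zero    = ≡⇒≈ (∑-cong p (λ r _ → cong F (sym (ℤₚ.+-identityʳ (+ r)))))
  ∑-shift-ℕ F F-cong (suc a) =
    ≈-trans (∑-shift-ℕ F F-cong a) (≈-trans shift-by-1 (≡⇒≈ (∑-cong p (λ r _ → cong F (reassoc r)))))
    where
    G : ℕ → ℤ
    G r = F (+ r + + a)
    reassoc : ∀ r → + suc r + + a ≡ + r + + suc a
    reassoc r = trans (cong (_+ + a) (ℤₚ.pos-+ 1 r))
                      (trans (lemma (+ 1) (+ r) (+ a)) (cong (_+_ (+ r)) (sym (ℤₚ.pos-+ 1 a))))
      where
      lemma : ∀ o r a → o + r + a ≡ r + (o + a)
      lemma = solve-∀
    X = ∑ p G
    Y = ∑ p (λ r → G (suc r))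
    G[p]≈G[0] : G p ≈ G 0
    G[p]≈G[0] = F-cong (+-congʳ (+ a) p≈0)
    lemma : ∀ x y g₀ gₚ → x - y ≡ (g₀ - gₚ) + ((x + gₚ) - (g₀ + y))
    lemma = solve-∀
    shift-by-1 : X ≈ Y
    shift-by-1 = x-y≈0⇒x≈y (≈-trans (≡⇒≈ (trans (lemma X Y (G 0) (G p))
                                                 (cong (λ z → (G 0 - G p) + ((X + G p) - z)) (∑-snoc p G))))
                                    (≈-trans (+-cong (x≈y⇒x-y≈0 (≈-sym G[p]≈G[0])) (≡⇒≈ (ℤₚ.+-inverseʳ (X + G p)))) ≈-refl))

  ∑-shift : ∀ F → F Preserves _≈_ ⟶ _≈_ → ∀ t → ∑ p (λ r → F (+ r)) ≈ ∑ p (λ r → F (+ r + t))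
  ∑-shift F F-cong t = ≈-trans (∑-shift-ℕ F F-cong (reduce t))
                               (∑-cong≈ p (λ r _ → F-cong (+-congˡ (+ r) (≈-sym (x≈reduce[x] t)))))

  ∑-over-squares : ∀ Φ → Φ Preserves _≈_ ⟶ _≈_ → ∑ p (λ s → Φ ((+ s) * (+ s))) ≈ ∑ p (λ d → Φ (+ d) * rootCount (+ d))
  ∑-over-squares Φ Φ-cong = ≈-sym (≈-trans (≡⇒≈ swap) (∑-cong≈ p (λ s _ → ∑-𝟙[w≈d] Φ Φ-cong ((+ s) * (+ s)))))
    where
    𝟙[s²≈d] : ℕ → ℕ → ℤ
    𝟙[s²≈d] s d = 𝟙 (≈0? ((+ s) * (+ s) - + d))
    swap : ∑ p (λ d → Φ (+ d) * rootCount (+ d)) ≡ ∑ p (λ s → ∑ p (λ d → 𝟙[s²≈d] s d * Φ (+ d)))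
    swap = trans (∑-cong p (λ d _ → sym (∑-*ˡ p (Φ (+ d)) (λ s → 𝟙[s²≈d] s d))))
           (trans (∑-comm p p (λ d s → Φ (+ d) * 𝟙[s²≈d] s d))
                  (∑-cong p (λ s _ → ∑-cong p (λ d _ → ℤₚ.*-comm (Φ (+ d)) (𝟙[s²≈d] s d)))))

  opaque
    -- Sealed, so that the linearity lemmas below can be applied by higher-order unification.
    ∑ₚ : (ℤ → ℤ) → ℤ
    ∑ₚ F = ∑ p (λ s → F (+ s))

    ∑ₚ-unfold : ∀ F → ∑ₚ F ≡ ∑ p (λ s → F (+ s))
    ∑ₚ-unfold F = refl

    ∑ₚ-cong≈ : ∀ {F G} → (∀ x → F x ≈ G x) → ∑ₚ F ≈ ∑ₚ G
    ∑ₚ-cong≈ F≈G = ∑-cong≈ p (λ s _ → F≈G (+ s))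

    ∑ₚ-distrib-+ : ∀ F G → ∑ₚ (λ x → F x + G x) ≡ ∑ₚ F + ∑ₚ G
    ∑ₚ-distrib-+ F G = ∑-distrib-+ p (λ s → F (+ s)) (λ s → G (+ s))

    ∑ₚ-distrib-minus : ∀ F G → ∑ₚ (λ x → F x - G x) ≡ ∑ₚ F - ∑ₚ G
    ∑ₚ-distrib-minus F G = ∑-distrib-minus p (λ s → F (+ s)) (λ s → G (+ s))

    ∑ₚ-*ˡ : ∀ a F → ∑ₚ (λ x → a * F x) ≡ a * ∑ₚ F
    ∑ₚ-*ˡ a F = ∑-*ˡ p a (λ s → F (+ s))

  ∑ₚ-cong : ∀ {F G} → (∀ x → F x ≡ G x) → ∑ₚ F ≈ ∑ₚ G
  ∑ₚ-cong F≡G = ∑ₚ-cong≈ (λ x → ≡⇒≈ (F≡G x))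

  ∑ₚ-+ : ∀ {F G a b} → ∑ₚ F ≈ a → ∑ₚ G ≈ b → ∑ₚ (λ x → F x + G x) ≈ a + b
  ∑ₚ-+ {F} {G} ΣF ΣG = ≈-trans (≡⇒≈ (∑ₚ-distrib-+ F G)) (+-cong ΣF ΣG)

  ∑ₚ-minus : ∀ {F G a b} → ∑ₚ F ≈ a → ∑ₚ G ≈ b → ∑ₚ (λ x → F x - G x) ≈ a - b
  ∑ₚ-minus {F} {G} ΣF ΣG = ≈-trans (≡⇒≈ (∑ₚ-distrib-minus F G)) (minus-cong ΣF ΣG)

  ∑ₚ-* : ∀ c {F a} → ∑ₚ F ≈ a → ∑ₚ (λ x → c * F x) ≈ c * a
  ∑ₚ-* c {F} ΣF = ≈-trans (≡⇒≈ (∑ₚ-*ˡ c F)) (*-congˡ c ΣF)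

  ∑ₚ-shift : ∀ F → F Preserves _≈_ ⟶ _≈_ → ∀ t → ∑ₚ F ≈ ∑ₚ (λ x → F (x + t))
  ∑ₚ-shift F F-cong t = subst₂ _≈_ (sym (∑ₚ-unfold F)) (sym (∑ₚ-unfold (λ x → F (x + t)))) (∑-shift F F-cong t)

  ∑ₚ-power≈0 : ∀ j → 0 ℕ.< j → j ℕ.< m ℕ.+ m → ∑ₚ (λ x → x ^ j) ≈ 0ℤ
  ∑ₚ-power≈0 j 0<j j<2m = ≈-trans (≡⇒≈ (∑ₚ-unfold (λ x → x ^ j))) (powerSum≈0 j 0<j j<2m)

  𝟙[≈0]-cong : ∀ {x y} → x ≈ y → 𝟙 (≈0? x) ≈ 𝟙 (≈0? y)
  𝟙[≈0]-cong {x} {y} x≈y = ≡⇒≈ (𝟙-cong (≈0? x) (≈0? y) (≈-trans (≈-sym x≈y)) (≈-trans x≈y))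

  𝟙[≈0]-neg : ∀ x → 𝟙 (≈0? (- x)) ≡ 𝟙 (≈0? x)
  𝟙[≈0]-neg x = 𝟙-cong (≈0? (- x)) (≈0? x) (λ -x≈0 → ≈-trans (≡⇒≈ (sym (ℤₚ.neg-involutive x))) (neg-cong -x≈0)) neg-cong

  ∑ₚ-𝟙[x≈a] : ∀ Φ → Φ Preserves _≈_ ⟶ _≈_ → ∀ a → ∑ₚ (λ x → 𝟙 (≈0? (x - a)) * Φ x) ≈ Φ a
  ∑ₚ-𝟙[x≈a] Φ Φ-cong a =
    ≈-trans (≡⇒≈ (trans (∑ₚ-unfold _) (∑-cong p (λ s _ → cong (_* Φ (+ s))
                                                          (trans (cong (λ z → 𝟙 (≈0? z)) (swap (+ s) a)) (𝟙[≈0]-neg (a - + s)))))))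
            (∑-𝟙[w≈d] Φ Φ-cong a)
    where
    swap : ∀ x a → x - a ≡ - (a - x)
    swap = solve-∀

  ∑ₚ[x-a]^m≈0 : ∀ a → ∑ₚ (λ x → (x - a) ^ m) ≈ 0ℤ
  ∑ₚ[x-a]^m≈0 a = ≈-trans (∑ₚ-shift (λ x → (x - a) ^ m) (λ x≈y → ^-cong m (minus-congʳ a x≈y)) a)
                          (≈-trans (∑ₚ-cong (λ x → cong (_^ m) (cancel x a))) (∑ₚ-power≈0 m 0<m (ℕₚ.m<m+n m 0<m)))
    where
    cancel : ∀ x a → x + a - a ≡ x
    cancel = solve-∀

  [-x-a]^m≡ : ∀ x a → (- x - a) ^ m ≡ (- 1ℤ) ^ m * (x - - a) ^ m
  [-x-a]^m≡ x a = trans (cong (_^ m) (lemma x a)) (^-distrib-* (- 1ℤ) (x - - a) m)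
    where
    lemma : ∀ x a → - x - a ≡ - 1ℤ * (x - - a)
    lemma = solve-∀

  -- m ≡ j (mod 4) is read off from p ≡ 2j + 1 (mod 8).
  p%8≡1+2j⇒ : ∀ j → p % 8 ≡ suc (j ℕ.+ j) → (- 1ℤ) ^ m ≡ (- 1ℤ) ^ j × ½ ^ m ≈ re-iⁿ j - im-iⁿ j
  p%8≡1+2j⇒ j p%8≡1+2j = subst P (j′≡j) (ε≡ , ≈-trans ½^m≈re-im (≡⇒≈ σ≡))
    where
    P : ℕ → Set
    P i = (- 1ℤ) ^ m ≡ (- 1ℤ) ^ i × ½ ^ m ≈ re-iⁿ i - im-iⁿ i
    j′ q : ℕ
    j′ = m % 4
    q  = m / 4
    m≡j′+q*4 : m ≡ j′ ℕ.+ q ℕ.* 4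
    m≡j′+q*4 = m≡m%n+[m/n]*n m 4
    p≡1+2j′+q*8 : p ≡ suc (j′ ℕ.+ j′) ℕ.+ q ℕ.* 8
    p≡1+2j′+q*8 = trans (cong (λ n → suc (n ℕ.+ n)) m≡j′+q*4) (regroup j′ q)
      where
      regroup : ∀ j q → suc ((j ℕ.+ q ℕ.* 4) ℕ.+ (j ℕ.+ q ℕ.* 4)) ≡ suc (j ℕ.+ j) ℕ.+ q ℕ.* 8
      regroup = solve-ℕ
    1+2j′<8 : suc (j′ ℕ.+ j′) ℕ.< 8
    1+2j′<8 = s≤s (s≤s (ℕₚ.+-mono-≤ (ℕₚ.≤-pred (m%n<n m 4)) (ℕₚ.≤-pred (m%n<n m 4))))
    p%8≡1+2j′ : p % 8 ≡ suc (j′ ℕ.+ j′)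
    p%8≡1+2j′ = trans (cong (_% 8) p≡1+2j′+q*8) (trans ([m+kn]%n≡m%n (suc (j′ ℕ.+ j′)) q 8) (m<n⇒m%n≡m 1+2j′<8))
    j′≡j : j′ ≡ j
    j′≡j = j+j≡k+k⇒j≡k j′ j (ℕₚ.suc-injective (trans (sym p%8≡1+2j′) p%8≡1+2j))
    ε≡ : (- 1ℤ) ^ m ≡ (- 1ℤ) ^ j′
    ε≡ = trans (cong ((- 1ℤ) ^_) m≡j′+q*4) ([-1]^-periodic q j′)
    σ≡ : re-iⁿ m - im-iⁿ m ≡ re-iⁿ j′ - im-iⁿ j′
    σ≡ = trans (cong (λ n → re-iⁿ n - im-iⁿ n) m≡j′+q*4) (cong₂ _-_ (proj₁ (iⁿ-periodic q j′)) (proj₂ (iⁿ-periodic q j′)))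

-- V/64 and W/8 of the theorem, where ε, γ and σ are the residues of (−1)^m, c^m ≡ (c/p)
-- and 2^(−m) ≡ (2/p) modulo p = 2m + 1.
V W : ℤ → ℤ → ℤ → ℤ
V ε γ σ = - + 4 - ε - + 4 * (ε * γ * σ)
W ε γ σ = + 4 + ε - + 2 * (ε * γ) + + 2 * (ε * γ * σ)

CongVW-from-64 : ∀ p {S c e v w} → Congruence._≈_ p (+ 64 * S) (v * (c * c) + + 8 * w * e) → CongVW p S c e v w
CongVW-from-64 p {S} {c} {e} {v} {w} 64S≈ i p∣64i-1 = ∣⇒∣ᵤ (≈0⇒∣ (x≈y⇒x-y≈0 (begin
    S
  ≡⟨ sym (ℤₚ.*-identityʳ S) ⟩
    S * 1ℤ
  ≈⟨ *-congˡ S (≈-sym (x-y≈0⇒x≈y (∣⇒≈0 (∣ᵤ⇒∣ p∣64i-1)))) ⟩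
    S * (+ 64 * i)
  ≡⟨ reorder S i ⟩
    i * (+ 64 * S)
  ≈⟨ *-congˡ i 64S≈ ⟩
    i * (v * (c * c) + + 8 * w * e)
  ≡⟨ distribute i v w c e ⟩
    v * i * (c * c) + w * (+ 8 * i) * e
  ∎)))
  where
  open Congruence p
  open SetoidReasoning ≈-setoid
  reorder : ∀ S i → S * (+ 64 * i) ≡ i * (+ 64 * S)
  reorder = solve-∀
  distribute : ∀ i v w c e → i * (v * (c * c) + + 8 * w * e) ≡ v * i * (c * c) + w * (+ 8 * i) * e
  distribute = solve-∀

module QuarticResidues (m : ℕ) (prime : Prime (suc (m ℕ.+ m))) (3≤m : 3 ℕ.≤ m) (c e : ℤ)
                       (p∤c : ¬ (+ suc (m ℕ.+ m) ∣ c)) where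

  open PrimeField m prime public

  ∣⇒≈0′ : ∀ {z} → + p ∣ z → z ≈ 0ℤ
  ∣⇒≈0′ p∣z = ∣⇒≈0 (∣ᵤ⇒∣ p∣z)

  ≈0⇒∣′ : ∀ {z} → z ≈ 0ℤ → + p ∣ z
  ≈0⇒∣′ z≈0 = ∣⇒∣ᵤ (≈0⇒∣ z≈0)

  c≉0 : ¬ (c ≈ 0ℤ)
  c≉0 c≈0 = p∤c (≈0⇒∣′ c≈0)

  -- x⁴ + c x² + e = (x² + h)² + k with h = c / 2.
  h k : ℤ
  h = c * ½
  k = e - h * h

  -h-h≈-c : - h - h ≈ - c
  -h-h≈-c = ≈-trans (≡⇒≈ (lemma c ½)) (neg-cong (≈-trans (*-congˡ c 2*½≈1) (≡⇒≈ (ℤₚ.*-identityʳ c))))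
    where
    lemma : ∀ c t → - (c * t) - c * t ≡ - (c * (+ 2 * t))
    lemma = solve-∀

  -h-h≉0 : ¬ (- h - h ≈ 0ℤ)
  -h-h≉0 -h-h≈0 = c≉0 (≈-trans (≡⇒≈ (sym (ℤₚ.neg-involutive c))) (neg-cong (≈-trans (≈-sym -h-h≈-c) -h-h≈0)))

  h≉0 : ¬ (h ≈ 0ℤ)
  h≉0 h≈0 = -h-h≉0 (≈-trans (minus-cong (neg-cong h≈0) h≈0) ≈-refl)

  0-h≉0 : ¬ (0ℤ - h ≈ 0ℤ)
  0-h≉0 0-h≈0 = h≉0 (≈-trans (≡⇒≈ (sym (ℤₚ.neg-involutive h))) (neg-cong (≈-trans (≡⇒≈ (sym (ℤₚ.+-identityˡ (- h)))) 0-h≈0)))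

  -- The residue class d is a value of (y² + h)², witnessed by u = y² + h.
  InImage : ℤ → Set
  InImage d = ∃ λ u → IsSquare (u - h) × (u * u - d ≈ 0ℤ)

  InImage-resp : ∀ {d d′} → d ≈ d′ → InImage d → InImage d′
  InImage-resp d≈d′ (u , sq , u²≈d) = u , sq , ≈-trans (minus-cong (≈-refl {u * u}) (≈-sym d≈d′)) u²≈d

  InImage? : ∀ d → Dec (InImage d)
  InImage? d with ℕₚ.anyUpTo? (λ u → IsSquare? (+ u - h) ×-dec ≈0? (+ u * + u - d)) p
  ... | yes (u , _ , sq , u²≈d) = yes (+ u , sq , u²≈d)
  ... | no  none                = no λ where
    (u , sq , u²≈d) → none (reduce u , reduce<p u ,
                            IsSquare-resp (minus-cong (x≈reduce[x] u) (≈-refl {h})) sq ,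
                            ≈-trans (minus-cong (*-cong (≈-sym (x≈reduce[x] u)) (≈-sym (x≈reduce[x] u))) (≈-refl {d})) u²≈d)

  IsResidue : ℕ → Set
  IsResidue r = ∃ λ x → + p ∣ (quartic c e x - + r)

  residue⇒InImage : ∀ r → IsResidue r → InImage (+ r - k)
  residue⇒InImage r (x , p∣f[x]-r) =
    x * x + h , (x , ≡⇒≈ (lemma x h)) ,
    ≈-trans (x-y≈0⇒x≈y (≈-trans (≡⇒≈ (trans (identity x c e (+ r) (+ m)) (cong ((c * x * x) *_) (sym p≡1+2m))))
                                (k*p≈0 (c * x * x))))
            (∣⇒≈0′ p∣f[x]-r)
    where
    lemma : ∀ x h → x * x - (x * x + h - h) ≡ 0ℤ
    lemma = solve-∀
    identity : ∀ x c e r M →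
      (x * x + c * (1ℤ + M)) * (x * x + c * (1ℤ + M)) - (r - (e - c * (1ℤ + M) * (c * (1ℤ + M))))
        - (x * (x * (x * (x * 1ℤ))) + c * (x * (x * 1ℤ)) + e - r)
      ≡ (c * x * x) * (1ℤ + (M + M))
    identity = solve-∀

  InImage⇒residue : ∀ r → InImage (+ r - k) → IsResidue r
  InImage⇒residue r (u , (y , y²-[u-h]≈0) , u²≈r-k) =
    y , ≈0⇒∣′ (≈-trans f[y]-r≈ (≈-trans (x-y≈0⇒x≈y (≈-trans (≡⇒≈ (trans (identity u c e (+ r) (+ m))
                                                                     (cong ((- c * (u - h)) *_) (sym p≡1+2m))))
                                                           (k*p≈0 (- c * (u - h)))))
                                        u²≈r-k))
    where
    y²≈u-h : y * y ≈ u - h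
    y²≈u-h = x-y≈0⇒x≈y y²-[u-h]≈0
    f[y]-r≈ : quartic c e y - + r ≈ (u - h) * (u - h) + c * (u - h) + e - + r
    f[y]-r≈ = ≈-trans (≡⇒≈ (regroup y c e (+ r)))
                      (minus-congʳ (+ r) (+-congʳ e (+-cong (*-cong y²≈u-h y²≈u-h) (*-congˡ c y²≈u-h))))
      where
      regroup : ∀ y c e r → y * (y * (y * (y * 1ℤ))) + c * (y * (y * 1ℤ)) + e - r ≡ (y * y) * (y * y) + c * (y * y) + e - r
      regroup = solve-∀
    identity : ∀ u c e r M →
      (u - c * (1ℤ + M)) * (u - c * (1ℤ + M)) + c * (u - c * (1ℤ + M)) + e - r - (u * u - (r - (e - c * (1ℤ + M) * (c * (1ℤ + M)))))
      ≡ (- c * (u - c * (1ℤ + M))) * (1ℤ + (M + M))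
    identity = solve-∀

  q g : ℤ → ℤ
  q w = 𝟙 (IsSquare? w)
  g d = 𝟙 (InImage? d)

  g-cong : g Preserves _≈_ ⟶ _≈_
  g-cong {x} {y} x≈y = ≡⇒≈ (𝟙-cong (InImage? x) (InImage? y) (InImage-resp x≈y) (InImage-resp (≈-sym x≈y)))

  -- s² ≈ u² iff u ≈ ±s, so s² is in the image iff s − h or −s − h is a square.
  g[s²]≡ : ∀ s → g (s * s) ≡ q (s - h) + q (- s - h) - q (s - h) * q (- s - h)
  g[s²]≡ s = 𝟙-⊎ (IsSquare? (s - h)) (IsSquare? (- s - h)) (InImage? (s * s)) roots (λ sq → s , sq , ≡⇒≈ (ℤₚ.+-inverseʳ (s * s)))
                 (λ sq → - s , sq , ≡⇒≈ (-s*-s-s*s≡0 s))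
    where
    -s*-s-s*s≡0 : ∀ s → - s * - s - s * s ≡ 0ℤ
    -s*-s-s*s≡0 = solve-∀
    factor : ∀ u s → (u - s) * (u + s) ≡ u * u - s * s
    factor = solve-∀
    u+s≡u--s : ∀ u s → u + s ≡ u - - s
    u+s≡u--s = solve-∀
    roots : InImage (s * s) → IsSquare (s - h) ⊎ IsSquare (- s - h)
    roots (u , sq , u²≈s²) =
      Sum.map (λ u-s≈0 → IsSquare-resp (minus-congʳ h (x-y≈0⇒x≈y {u} {s} u-s≈0)) sq)
              (λ u+s≈0 → IsSquare-resp (minus-congʳ h (x-y≈0⇒x≈y {u} { - s} (≈-trans (≡⇒≈ (sym (u+s≡u--s u s))) u+s≈0))) sq)
              (x*y≈0⇒x≈0⊎y≈0 (u - s) (u + s) (≈-trans (≡⇒≈ (factor u s)) u²≈s²))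

  InImage⇒IsSquare : ∀ {d} → InImage d → IsSquare d
  InImage⇒IsSquare (u , _ , u²≈d) = u , u²≈d

  g[d]*d^m≈g[d]-𝟙[d≈0]*g[d] : ∀ d → g d * d ^ m ≈ g d - 𝟙 (≈0? d) * g d
  g[d]*d^m≈g[d]-𝟙[d≈0]*g[d] d = by-cases (InImage? d) (≈0? d)
    where
    by-cases : (img? : Dec (InImage d)) (d≈0? : Dec (d ≈ 0ℤ)) → 𝟙 img? * d ^ m ≈ 𝟙 img? - 𝟙 d≈0? * 𝟙 img?
    by-cases (no _)    d≈0?      = ≡⇒≈ (trans (ℤₚ.*-zeroˡ (d ^ m)) (sym (cong (_-_ 0ℤ) (ℤₚ.*-zeroʳ (𝟙 d≈0?)))))
    by-cases (yes _)   (yes d≈0) = *-congˡ 1ℤ (x≈0⇒x^n≈0 m 0<m d≈0)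
    by-cases (yes img) (no d≉0)  = *-congˡ 1ℤ (IsSquare⇒z^m≈1 d (InImage⇒IsSquare img) d≉0)

  g[d]*[d*d^m]≈g[d]*d : ∀ d → g d * (d * d ^ m) ≈ g d * d
  g[d]*[d*d^m]≈g[d]*d d = by-cases (InImage? d) (≈0? d)
    where
    by-cases : (img? : Dec (InImage d)) (d≈0? : Dec (d ≈ 0ℤ)) → 𝟙 img? * (d * d ^ m) ≈ 𝟙 img? * d
    by-cases (no _)    _         = ≡⇒≈ (trans (ℤₚ.*-zeroˡ (d * d ^ m)) (sym (ℤₚ.*-zeroˡ d)))
    by-cases (yes _)   (yes d≈0) = *-congˡ 1ℤ (≈-trans (*-congʳ (d ^ m) d≈0) (≈-trans (≡⇒≈ (ℤₚ.*-zeroˡ (d ^ m))) (≈-sym d≈0)))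
    by-cases (yes img) (no d≉0)  = *-congˡ 1ℤ (≈-trans (*-congˡ d (IsSquare⇒z^m≈1 d (InImage⇒IsSquare img) d≉0))
                                                       (≡⇒≈ (ℤₚ.*-identityʳ d)))

  m+2<m+m : suc (suc m) ℕ.< m ℕ.+ m
  m+2<m+m = subst (suc (suc m) ℕ.<_) (ℕₚ.+-comm m m) (ℕₚ.+-monoˡ-< m 3≤m)

  ∑ₚx²[x-a]^m≈0 : ∀ a → ∑ₚ (λ x → x * x * (x - a) ^ m) ≈ 0ℤ
  ∑ₚx²[x-a]^m≈0 a =
    ≈-trans (∑ₚ-shift (λ x → x * x * (x - a) ^ m) (λ x≈y → *-cong (*-cong x≈y x≈y) (^-cong m (minus-congʳ a x≈y))) a)
    (≈-trans (∑ₚ-cong (λ x → trans (cong (λ z → (x + a) * (x + a) * z ^ m) (cancel x a)) (expand x a (x ^ m))))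
    (≈-trans (∑ₚ-+ (∑ₚ-+ (∑ₚ-power≈0 (suc (suc m)) (s≤s z≤n) m+2<m+m)
                         (∑ₚ-* (+ 2 * a) (∑ₚ-power≈0 (suc m) (s≤s z≤n) (ℕₚ.<-trans (ℕₚ.n<1+n (suc m)) m+2<m+m))))
                   (∑ₚ-* (a * a) (∑ₚ-power≈0 m 0<m (ℕₚ.m<m+n m 0<m))))
             (≡⇒≈ (zeros (+ 2 * a) (a * a)))))
    where
    cancel : ∀ x a → x + a - a ≡ x
    cancel = solve-∀
    expand : ∀ x a y → (x + a) * (x + a) * y ≡ x * (x * y) + (+ 2 * a) * (x * y) + (a * a) * y
    expand = solve-∀
    zeros : ∀ a b → 0ℤ + a * 0ℤ + b * 0ℤ ≡ 0ℤ
    zeros = solve-∀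

  E E′ δ δ′ : ℤ → ℤ
  E  x = (x - h) ^ m
  E′ x = (- x - h) ^ m
  δ  x = 𝟙 (≈0? (x - h))
  δ′ x = 𝟙 (≈0? (- x - h))

  ∑ₚE≈0 : ∑ₚ E ≈ 0ℤ
  ∑ₚE≈0 = ∑ₚ[x-a]^m≈0 h

  ∑ₚE′≈0 : ∑ₚ E′ ≈ 0ℤ
  ∑ₚE′≈0 = ≈-trans (∑ₚ-cong (λ x → [-x-a]^m≡ x h))
                   (≈-trans (∑ₚ-* ((- 1ℤ) ^ m) (∑ₚ[x-a]^m≈0 (- h))) (≡⇒≈ (ℤₚ.*-zeroʳ ((- 1ℤ) ^ m))))

  ∑ₚx²E≈0 : ∑ₚ (λ x → x * x * E x) ≈ 0ℤ
  ∑ₚx²E≈0 = ∑ₚx²[x-a]^m≈0 h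

  ∑ₚx²E′≈0 : ∑ₚ (λ x → x * x * E′ x) ≈ 0ℤ
  ∑ₚx²E′≈0 = ≈-trans (∑ₚ-cong (λ x → trans (cong (x * x *_) ([-x-a]^m≡ x h)) (lemma (x * x) ((- 1ℤ) ^ m) ((x - - h) ^ m))))
                     (≈-trans (∑ₚ-* ((- 1ℤ) ^ m) (∑ₚx²[x-a]^m≈0 (- h))) (≡⇒≈ (ℤₚ.*-zeroʳ ((- 1ℤ) ^ m))))
    where
    lemma : ∀ a b c → a * (b * c) ≡ b * (a * c)
    lemma = solve-∀

  β : ℕ → ℤ
  β k = + (m C k) * ((- 1ℤ) ^ k * (h * h) ^ (m ∸ k))

  -- (x − h)(−x − h) = h² − x²
  E*E′≡ : ∀ x → E x * E′ x ≡ ∑ (suc m) (λ k → β k * x ^ (k ℕ.+ k))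
  E*E′≡ x =
    trans (sym (^-distrib-* (x - h) (- x - h) m))
    (trans (cong (_^ m) (product x h))
    (trans (binomial-theorem (- (x * x)) (h * h) m)
           (∑-cong (suc m) (λ k _ → trans (cong (λ z → + (m C k) * (z * (h * h) ^ (m ∸ k)))
                                                (trans (cong (_^ k) (sym (ℤₚ.-1*i≡-i (x * x))))
                                                       (trans (^-distrib-* (- 1ℤ) (x * x) k)
                                                              (cong ((- 1ℤ) ^ k *_) ([x*x]^k≡x^[k+k] x k)))))
                                          (regroup (+ (m C k)) ((- 1ℤ) ^ k) (x ^ (k ℕ.+ k)) ((h * h) ^ (m ∸ k)))))))
    where
    product : ∀ x h → (x - h) * (- x - h) ≡ - (x * x) + h * h
    product = solve-∀
    regroup : ∀ c a X b → c * (a * X * b) ≡ c * (a * b) * X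
    regroup = solve-∀

  ∑ₚ-w*E*E′≡ : ∀ (w : ℤ → ℤ) → ∑ₚ (λ x → w x * (E x * E′ x)) ≡ ∑ (suc m) (λ k → β k * ∑ₚ (λ x → w x * x ^ (k ℕ.+ k)))
  ∑ₚ-w*E*E′≡ w =
    trans (∑ₚ-unfold (λ x → w x * (E x * E′ x)))
    (trans (∑-cong p (λ s _ → trans (cong (w (+ s) *_) (E*E′≡ (+ s))) (sym (∑-*ˡ (suc m) (w (+ s)) (λ k → β k * (+ s) ^ (k ℕ.+ k))))))
    (trans (∑-comm p (suc m) (λ s k → w (+ s) * (β k * (+ s) ^ (k ℕ.+ k))))
           (∑-cong (suc m) (λ k _ → trans (∑-cong p (λ s _ → swap (w (+ s)) (β k) ((+ s) ^ (k ℕ.+ k))))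
                                          (trans (∑-*ˡ p (β k) (λ s → w (+ s) * (+ s) ^ (k ℕ.+ k)))
                                                 (cong (β k *_) (sym (∑ₚ-unfold (λ x → w x * x ^ (k ℕ.+ k))))))))))
    where
    swap : ∀ a b c → a * (b * c) ≡ b * (a * c)
    swap = solve-∀

  ∑ₚx^[k+k]≈0 : ∀ k → k ℕ.< m → ∑ₚ (λ x → x ^ (k ℕ.+ k)) ≈ 0ℤ
  ∑ₚx^[k+k]≈0 zero    _   = ≈-trans (≡⇒≈ (∑ₚ-unfold _)) powerSum-0
  ∑ₚx^[k+k]≈0 (suc k) k<m = ∑ₚ-power≈0 (suc k ℕ.+ suc k) (s≤s z≤n) (ℕₚ.+-mono-< k<m k<m)

  ∑ₚE*E′≈ : ∑ₚ (λ x → 1ℤ * (E x * E′ x)) ≈ - (- 1ℤ) ^ m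
  ∑ₚE*E′≈ =
    ≈-trans (≡⇒≈ (∑ₚ-w*E*E′≡ (λ _ → 1ℤ)))
    (≈-trans (∑-support₁ (suc m) m _ ℕₚ.≤-refl off≈0)
    (≈-trans (*-congˡ (β m) (≈-trans (∑ₚ-cong (λ x → ℤₚ.*-identityˡ _))
                                     (≈-trans (≡⇒≈ (∑ₚ-unfold _)) powerSum[p-1]≈-1)))
             (≡⇒≈ (trans (cong₂ (λ a b → + a * ((- 1ℤ) ^ m * (h * h) ^ b) * - 1ℤ) (nCn≡1 m) (ℕₚ.n∸n≡0 m))
                         (simplify ((- 1ℤ) ^ m))))))
    where
    simplify : ∀ ε → + 1 * (ε * 1ℤ) * - 1ℤ ≡ - ε
    simplify = solve-∀
    off≈0 : ∀ k → k ℕ.< suc m → k ≢ m → β k * ∑ₚ (λ x → 1ℤ * x ^ (k ℕ.+ k)) ≈ 0ℤ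
    off≈0 k k≤m k≢m =
      ≈-trans (*-congˡ (β k) (≈-trans (∑ₚ-cong (λ x → ℤₚ.*-identityˡ _)) (∑ₚx^[k+k]≈0 k (ℕₚ.≤∧≢⇒< (ℕₚ.≤-pred k≤m) k≢m))))
              (≡⇒≈ (ℤₚ.*-zeroʳ (β k)))

  m₁ : ℕ
  m₁ = m ∸ 1

  1+m₁≡m : suc m₁ ≡ m
  1+m₁≡m = ℕₚ.m+[n∸m]≡n {1} {m} 0<m

  ∑ₚx²x^[k+k]≈0 : ∀ k → k ℕ.< suc m → k ≢ m₁ → ∑ₚ (λ x → x * x * x ^ (k ℕ.+ k)) ≈ 0ℤ
  ∑ₚx²x^[k+k]≈0 k k≤m k≢m₁ = ≈-trans (∑ₚ-cong (λ x → ℤₚ.*-assoc x x (x ^ (k ℕ.+ k)))) (vanishes (ℕₚ.<-cmp k m₁))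
    where
    vanishes : Tri (k ℕ.< m₁) (k ≡ m₁) (m₁ ℕ.< k) → ∑ₚ (λ x → x ^ suc (suc (k ℕ.+ k))) ≈ 0ℤ
    vanishes (tri≈ _ k≡m₁ _) = ⊥-elim (k≢m₁ k≡m₁)
    vanishes (tri< k<m₁ _ _) =
      ∑ₚ-power≈0 _ (s≤s z≤n) (subst (suc (suc (k ℕ.+ k)) ℕ.<_) (cong₂ ℕ._+_ 1+m₁≡m 1+m₁≡m)
                                    (s≤s (subst (suc (k ℕ.+ k) ℕ.<_) (sym (ℕₚ.+-suc m₁ m₁)) (s≤s (ℕₚ.+-mono-< k<m₁ k<m₁)))))
    vanishes (tri> _ _ m₁<k) =
      ≈-trans (≡⇒≈ (trans (∑ₚ-unfold _) (cong (λ z → powerSum (suc (suc (z ℕ.+ z)))) k≡m)))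
              (≈-trans (powerSum-periodic 2 (s≤s z≤n)) (powerSum≈0 2 (s≤s z≤n) (ℕₚ.≤-trans 3≤m (ℕₚ.m≤m+n m m))))
      where
      k≡m : k ≡ m
      k≡m = ℕₚ.≤-antisym (ℕₚ.≤-pred k≤m) (subst (ℕ._≤ k) 1+m₁≡m m₁<k)

  -- With the weight x², only the term k = m − 1 of the expansion has exponent p − 1.
  ∑ₚx²E*E′≈ : ∑ₚ (λ x → x * x * (E x * E′ x)) ≈ + m * (- 1ℤ) ^ m * (h * h)
  ∑ₚx²E*E′≈ =
    ≈-trans (≡⇒≈ (∑ₚ-w*E*E′≡ (λ x → x * x)))
    (≈-trans (∑-support₁ (suc m) m₁ _ (s≤s (ℕₚ.m∸n≤m m 1)) off≈0)
    (≈-trans (*-congˡ (β m₁) (≈-trans (∑ₚ-cong (λ x → ℤₚ.*-assoc x x (x ^ (m₁ ℕ.+ m₁))))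
                                      (≈-trans (≡⇒≈ (trans (∑ₚ-unfold _) (cong powerSum 2+[m₁+m₁]≡m+m))) powerSum[p-1]≈-1)))
             (≡⇒≈ β[m₁]*-1≡)))
    where
    2+[m₁+m₁]≡m+m : suc (suc (m₁ ℕ.+ m₁)) ≡ m ℕ.+ m
    2+[m₁+m₁]≡m+m = trans (cong suc (sym (ℕₚ.+-suc m₁ m₁))) (cong₂ ℕ._+_ 1+m₁≡m 1+m₁≡m)
    off≈0 : ∀ k → k ℕ.< suc m → k ≢ m₁ → β k * ∑ₚ (λ x → x * x * x ^ (k ℕ.+ k)) ≈ 0ℤ
    off≈0 k k≤m k≢m₁ = ≈-trans (*-congˡ (β k) (∑ₚx²x^[k+k]≈0 k k≤m k≢m₁)) (≡⇒≈ (ℤₚ.*-zeroʳ (β k)))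
    m∸m₁≡1 : m ∸ m₁ ≡ 1
    m∸m₁≡1 = trans (cong (_∸ m₁) (sym 1+m₁≡m)) (ℕₚ.m+n∸n≡m 1 m₁)
    β[m₁]*-1≡ : β m₁ * - 1ℤ ≡ + m * (- 1ℤ) ^ m * (h * h)
    β[m₁]*-1≡ = begin
        + (m C m₁) * ((- 1ℤ) ^ m₁ * (h * h) ^ (m ∸ m₁)) * - 1ℤ
      ≡⟨ cong₂ (λ a b → + a * ((- 1ℤ) ^ m₁ * (h * h) ^ b) * - 1ℤ)
               (trans (nCk≡nC[n∸k] (ℕₚ.m∸n≤m m 1)) (trans (cong (m C_) m∸m₁≡1) (nC1≡n m))) m∸m₁≡1 ⟩
        + m * ((- 1ℤ) ^ m₁ * (h * h) ^ 1) * - 1ℤ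
      ≡⟨ regroup (+ m) ((- 1ℤ) ^ m₁) (h * h) ⟩
        + m * (- 1ℤ) ^ suc m₁ * (h * h)
      ≡⟨ cong (λ z → + m * (- 1ℤ) ^ z * (h * h)) 1+m₁≡m ⟩
        + m * (- 1ℤ) ^ m * (h * h)
      ∎
      where
      open ≡-Reasoning
      regroup : ∀ M ε H → M * (ε * (H * 1ℤ)) * - 1ℤ ≡ M * (- 1ℤ * ε) * H
      regroup = solve-∀

  E-cong : E Preserves _≈_ ⟶ _≈_
  E-cong x≈y = ^-cong m (minus-congʳ h x≈y)

  E′-cong : E′ Preserves _≈_ ⟶ _≈_
  E′-cong x≈y = ^-cong m (minus-congʳ h (neg-cong x≈y))

  δ′-cong : δ′ Preserves _≈_ ⟶ _≈_
  δ′-cong x≈y = 𝟙[≈0]-cong (minus-congʳ h (neg-cong x≈y))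

  ∑ₚ-δ : ∀ Φ → Φ Preserves _≈_ ⟶ _≈_ → ∑ₚ (λ x → δ x * Φ x) ≈ Φ h
  ∑ₚ-δ Φ Φ-cong = ∑ₚ-𝟙[x≈a] Φ Φ-cong h

  ∑ₚ-δ′ : ∀ Φ → Φ Preserves _≈_ ⟶ _≈_ → ∑ₚ (λ x → δ′ x * Φ x) ≈ Φ (- h)
  ∑ₚ-δ′ Φ Φ-cong =
    ≈-trans (∑ₚ-cong (λ x → cong (_* Φ x) (trans (cong (λ z → 𝟙 (≈0? z)) (lemma x h)) (𝟙[≈0]-neg (x - - h)))))
            (∑ₚ-𝟙[x≈a] Φ Φ-cong (- h))
    where
    lemma : ∀ x h → - x - h ≡ - (x - - h)
    lemma = solve-∀

  δ′[h]≡0 : δ′ h ≡ 0ℤ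
  δ′[h]≡0 = 𝟙-no (≈0? (- h - h)) -h-h≉0

  -- 4·g(x²) = 2U + 2U′ − U U′ for U = 2·q(x − h) ≈ 1 + E x + δ x and U′ = 2·q(−x − h) ≈ 1 + E′ x + δ′ x.
  4g[x²] : ℤ → ℤ
  4g[x²] x = + 3 + E x + E′ x + δ x + δ′ x - E x * E′ x - E x * δ′ x - δ x * E′ x - δ x * δ′ x

  4*g[x²]≈4g[x²] : ∀ x → + 4 * g (x * x) ≈ 4g[x²] x
  4*g[x²]≈4g[x²] x =
    ≈-trans (≡⇒≈ (trans (cong (+ 4 *_) (g[s²]≡ x)) (double (q (x - h)) (q (- x - h)))))
    (≈-trans (combine (2*𝟙[IsSquare]≈1+z^m+𝟙[z≈0] (x - h)) (2*𝟙[IsSquare]≈1+z^m+𝟙[z≈0] (- x - h)))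
             (≡⇒≈ (expand (E x) (E′ x) (δ x) (δ′ x))))
    where
    double : ∀ a b → + 4 * (a + b - a * b) ≡ + 2 * (+ 2 * a) + + 2 * (+ 2 * b) - (+ 2 * a) * (+ 2 * b)
    double = solve-∀
    combine : ∀ {U V U′ V′} → U ≈ U′ → V ≈ V′ → + 2 * U + + 2 * V - U * V ≈ + 2 * U′ + + 2 * V′ - U′ * V′
    combine U≈U′ V≈V′ = minus-cong (+-cong (*-congˡ (+ 2) U≈U′) (*-congˡ (+ 2) V≈V′)) (*-cong U≈U′ V≈V′)
    expand : ∀ e e′ d d′ → + 2 * (1ℤ + e + d) + + 2 * (1ℤ + e′ + d′) - (1ℤ + e + d) * (1ℤ + e′ + d′)
                         ≡ + 3 + e + e′ + d + d′ - e * e′ - e * d′ - d * e′ - d * d′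
    expand = solve-∀

  H : ℤ
  H = (- h - h) ^ m

  ∑ₚ-w*4g[x²] : ∀ w → w Preserves _≈_ ⟶ _≈_ → ∀ {D} →
                ∑ₚ w ≈ 0ℤ → ∑ₚ (λ x → w x * E x) ≈ 0ℤ → ∑ₚ (λ x → w x * E′ x) ≈ 0ℤ →
                ∑ₚ (λ x → w x * (E x * E′ x)) ≈ D →
                ∑ₚ (λ x → w x * 4g[x²] x) ≈ w h + w (- h) - D - (w (- h) + w h) * H
  ∑ₚ-w*4g[x²] w w-cong {D} Σw ΣwE ΣwE′ ΣwEE′ =
    ≈-trans (∑ₚ-cong (λ x → distribute (w x) (E x) (E′ x) (δ x) (δ′ x)))
    (≈-trans (∑ₚ-minus (∑ₚ-minus (∑ₚ-minus (∑ₚ-minus (∑ₚ-+ (∑ₚ-+ (∑ₚ-+ (∑ₚ-+ (∑ₚ-* (+ 3) Σw) ΣwE) ΣwE′)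
                                                  (∑ₚ-δ w w-cong))
                                           (∑ₚ-δ′ w w-cong))
                                    ΣwEE′)
                             (∑ₚ-δ′ (λ x → w x * E x) (λ x≈y → *-cong (w-cong x≈y) (E-cong x≈y))))
                      (∑ₚ-δ (λ x → w x * E′ x) (λ x≈y → *-cong (w-cong x≈y) (E′-cong x≈y))))
               (∑ₚ-δ (λ x → w x * δ′ x) (λ x≈y → *-cong (w-cong x≈y) (δ′-cong x≈y))))
             (≡⇒≈ (trans (cong (λ z → + 3 * 0ℤ + 0ℤ + 0ℤ + w h + w (- h) - D - w (- h) * H - w h * H - w h * z) δ′[h]≡0)
                         (simplify (w h) (w (- h)) D H))))
    where
    distribute : ∀ W e e′ d d′ →
      W * (+ 3 + e + e′ + d + d′ - e * e′ - e * d′ - d * e′ - d * d′)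
      ≡ + 3 * W + W * e + W * e′ + d * W + d′ * W - W * (e * e′) - d′ * (W * e) - d * (W * e′) - d * (W * d′)
    distribute = solve-∀
    simplify : ∀ a b D H → + 3 * 0ℤ + 0ℤ + 0ℤ + a + b - D - b * H - a * H - a * 0ℤ ≡ a + b - D - (b + a) * H
    simplify = solve-∀

  ∑ₚ4g[x²]≈ : ∑ₚ (λ x → 1ℤ * 4g[x²] x) ≈ 1ℤ + 1ℤ - - (- 1ℤ) ^ m - (1ℤ + 1ℤ) * H
  ∑ₚ4g[x²]≈ =
    ∑ₚ-w*4g[x²] (λ _ → 1ℤ) (λ _ → ≈-refl)
      (≈-trans (≡⇒≈ (trans (∑ₚ-unfold _) (trans (∑-const p 1ℤ) (ℤₚ.*-identityʳ (+ p))))) p≈0)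
      (≈-trans (∑ₚ-cong (λ x → ℤₚ.*-identityˡ (E x))) ∑ₚE≈0)
      (≈-trans (∑ₚ-cong (λ x → ℤₚ.*-identityˡ (E′ x))) ∑ₚE′≈0)
      ∑ₚE*E′≈

  ∑ₚx²4g[x²]≈ : ∑ₚ (λ x → x * x * 4g[x²] x) ≈ h * h + - h * - h - + m * (- 1ℤ) ^ m * (h * h) - (- h * - h + h * h) * H
  ∑ₚx²4g[x²]≈ =
    ∑ₚ-w*4g[x²] (λ x → x * x) (λ x≈y → *-cong x≈y x≈y)
      (≈-trans (∑ₚ-cong (λ x → cong (x *_) (sym (ℤₚ.*-identityʳ x)))) (∑ₚ-power≈0 2 (s≤s z≤n) (ℕₚ.≤-trans 3≤m (ℕₚ.m≤m+n m m))))
      ∑ₚx²E≈0 ∑ₚx²E′≈0 ∑ₚx²E*E′≈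

  IsResidue? : ∀ r → Dec (IsResidue r)
  IsResidue? r = map′ (InImage⇒residue r) (residue⇒InImage r) (InImage? (+ r - k))

  sum≈∑ₚ : ∀ L → IsResidueSet p (quartic c e) L → + sum L ≈ ∑ₚ (λ x → g (x - k) * x)
  sum≈∑ₚ L (unique , mem) =
    ≡⇒≈ (trans (sum≡∑-𝟙 L p IsResidue? unique mem)
               (trans (∑-cong p (λ r _ → cong (_* + r) (𝟙-cong (IsResidue? r) (InImage? (+ r - k)) (residue⇒InImage r) (InImage⇒residue r))))
                      (sym (∑ₚ-unfold (λ x → g (x - k) * x)))))

  A B : ℤ
  A = ∑ₚ (λ d → g d * d)
  B = ∑ₚ g

  ∑ₚg[x-k]*x≈A+k*B : ∑ₚ (λ x → g (x - k) * x) ≈ A + k * B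
  ∑ₚg[x-k]*x≈A+k*B =
    ≈-trans (∑ₚ-shift (λ x → g (x - k) * x) (λ x≈y → *-cong (g-cong (minus-congʳ k x≈y)) x≈y) k)
    (≈-trans (∑ₚ-cong≈ (λ x → ≈-trans (*-congʳ (x + k) (g-cong (≡⇒≈ (cancel x k)))) (≡⇒≈ (distrib (g x) x k))))
             (∑ₚ-+ ≈-refl (∑ₚ-* k ≈-refl)))
    where
    cancel : ∀ x k → x + k - k ≡ x
    cancel = solve-∀
    distrib : ∀ g x k → g * (x + k) ≡ g * x + k * g
    distrib = solve-∀

  ∑ₚ-over-squares : ∀ Φ → Φ Preserves _≈_ ⟶ _≈_ → ∑ₚ (λ x → Φ (x * x)) ≈ ∑ₚ (λ d → Φ d * (1ℤ + d ^ m))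
  ∑ₚ-over-squares Φ Φ-cong =
    ≈-trans (≡⇒≈ (∑ₚ-unfold _))
    (≈-trans (∑-over-squares Φ Φ-cong)
    (≈-trans (∑-cong≈ p (λ d _ → *-congˡ (Φ (+ d)) (rootCount≈1+z^m (+ d)))) (≡⇒≈ (sym (∑ₚ-unfold _)))))

  -- Each nonzero value of the image has two square roots.
  ∑ₚg[x²]*x²≈2A : ∑ₚ (λ x → g (x * x) * (x * x)) ≈ + 2 * A
  ∑ₚg[x²]*x²≈2A =
    ≈-trans (∑ₚ-over-squares (λ d → g d * d) (λ x≈y → *-cong (g-cong x≈y) x≈y))
    (≈-trans (∑ₚ-cong≈ (λ d → ≈-trans (≡⇒≈ (distrib (g d) d (d ^ m)))
                                     (≈-trans (+-congˡ (g d * d) (g[d]*[d*d^m]≈g[d]*d d)) (≡⇒≈ (double (g d * d))))))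
             (≡⇒≈ (∑ₚ-*ˡ (+ 2) (λ d → g d * d))))
    where
    distrib : ∀ g d t → g * d * (1ℤ + t) ≡ g * d + g * (d * t)
    distrib = solve-∀
    double : ∀ a → a + a ≡ + 2 * a
    double = solve-∀

  ∑ₚg[x²]+g[0]≈2B : ∑ₚ (λ x → g (x * x)) + g 0ℤ ≈ + 2 * B
  ∑ₚg[x²]+g[0]≈2B =
    ≈-trans (+-congʳ (g 0ℤ) (≈-trans (∑ₚ-over-squares g g-cong)
                            (≈-trans (∑ₚ-cong≈ pointwise) (∑ₚ-minus (≡⇒≈ (∑ₚ-*ˡ (+ 2) g)) ∑ₚ𝟙[d≈0]*g[d]≈g[0]))))
            (≡⇒≈ (cancel (+ 2 * B) (g 0ℤ)))
    where
    distrib : ∀ g t → g * (1ℤ + t) ≡ g + g * t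
    distrib = solve-∀
    collect : ∀ g z → g + (g - z * g) ≡ + 2 * g - z * g
    collect = solve-∀
    cancel : ∀ a g → a - g + g ≡ a
    cancel = solve-∀
    pointwise : ∀ d → g d * (1ℤ + d ^ m) ≈ + 2 * g d - 𝟙 (≈0? d) * g d
    pointwise d = ≈-trans (≡⇒≈ (distrib (g d) (d ^ m)))
                          (≈-trans (+-congˡ (g d) (g[d]*d^m≈g[d]-𝟙[d≈0]*g[d] d)) (≡⇒≈ (collect (g d) (𝟙 (≈0? d)))))
    ∑ₚ𝟙[d≈0]*g[d]≈g[0] : ∑ₚ (λ d → 𝟙 (≈0? d) * g d) ≈ g 0ℤ
    ∑ₚ𝟙[d≈0]*g[d]≈g[0] = ≈-trans (∑ₚ-cong (λ d → cong (λ z → 𝟙 (≈0? z) * g d) (sym (ℤₚ.+-identityʳ d))))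
                                 (∑ₚ-𝟙[x≈a] g g-cong 0ℤ)

  Z : ℤ
  Z = (0ℤ - h) ^ m

  2*g[0]≈1+Z : + 2 * g 0ℤ ≈ 1ℤ + Z
  2*g[0]≈1+Z =
    ≈-trans (≡⇒≈ (cong (+ 2 *_) (trans (g[s²]≡ 0ℤ) (𝟙-idempotent (IsSquare? (0ℤ - h))))))
    (≈-trans (2*𝟙[IsSquare]≈1+z^m+𝟙[z≈0] (0ℤ - h))
             (≡⇒≈ (trans (cong (_+_ (1ℤ + Z)) (𝟙-no (≈0? (0ℤ - h)) 0-h≉0))
                         (ℤₚ.+-identityʳ (1ℤ + Z)))))
    where
    𝟙-idempotent : ∀ {P : Set} (P? : Dec P) → 𝟙 P? + 𝟙 P? - 𝟙 P? * 𝟙 P? ≡ 𝟙 P?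
    𝟙-idempotent (yes _) = refl
    𝟙-idempotent (no _)  = refl

  ε : ℤ
  ε = (- 1ℤ) ^ m

  8*sum≈ : ∀ L → IsResidueSet p (quartic c e) L →
           + 8 * + sum L ≈ h * h * (+ 2 - + m * ε - + 2 * H) + k * (+ 4 + ε - + 2 * H + + 2 * Z)
  8*sum≈ L res = begin
      + 8 * + sum L
    ≈⟨ *-congˡ (+ 8) (≈-trans (sum≈∑ₚ L res) ∑ₚg[x-k]*x≈A+k*B) ⟩
      + 8 * (A + k * B)
    ≡⟨ regroup A B k ⟩
      + 4 * (+ 2 * A) + k * (+ 4 * (+ 2 * B))
    ≈⟨ +-cong (*-congˡ (+ 4) (≈-sym ∑ₚg[x²]*x²≈2A)) (*-congˡ k (*-congˡ (+ 4) (≈-sym ∑ₚg[x²]+g[0]≈2B))) ⟩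
      + 4 * ∑ₚ (λ x → g (x * x) * (x * x)) + k * (+ 4 * (∑ₚ (λ x → g (x * x)) + g 0ℤ))
    ≈⟨ +-cong 4X≈ (*-congˡ k (≈-trans (≡⇒≈ (split (∑ₚ (λ x → g (x * x))) (g 0ℤ)))
                                      (+-cong 4Y≈ (*-congˡ (+ 2) 2*g[0]≈1+Z)))) ⟩
      (h * h + - h * - h - + m * ε * (h * h) - (- h * - h + h * h) * H)
        + k * ((1ℤ + 1ℤ - - ε - (1ℤ + 1ℤ) * H) + + 2 * (1ℤ + Z))
    ≡⟨ simplify h k (+ m) ε H Z ⟩
      h * h * (+ 2 - + m * ε - + 2 * H) + k * (+ 4 + ε - + 2 * H + + 2 * Z)
    ∎
    where
    open ≈-Reasoning
    regroup : ∀ A B k → + 8 * (A + k * B) ≡ + 4 * (+ 2 * A) + k * (+ 4 * (+ 2 * B))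
    regroup = solve-∀
    split : ∀ Y g → + 4 * (Y + g) ≡ + 4 * Y + + 2 * (+ 2 * g)
    split = solve-∀
    simplify : ∀ h k M ε H Z →
      (h * h + - h * - h - M * ε * (h * h) - (- h * - h + h * h) * H) + k * ((1ℤ + 1ℤ - - ε - (1ℤ + 1ℤ) * H) + + 2 * (1ℤ + Z))
      ≡ h * h * (+ 2 - M * ε - + 2 * H) + k * (+ 4 + ε - + 2 * H + + 2 * Z)
    simplify = solve-∀
    4X≈ : + 4 * ∑ₚ (λ x → g (x * x) * (x * x)) ≈ h * h + - h * - h - + m * ε * (h * h) - (- h * - h + h * h) * H
    4X≈ = ≈-trans (≡⇒≈ (sym (∑ₚ-*ˡ (+ 4) (λ x → g (x * x) * (x * x)))))
                  (≈-trans (∑ₚ-cong≈ (λ x → ≈-trans (≡⇒≈ (reorder (g (x * x)) (x * x))) (*-congˡ (x * x) (4*g[x²]≈4g[x²] x))))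
                           ∑ₚx²4g[x²]≈)
      where
      reorder : ∀ g w → + 4 * (g * w) ≡ w * (+ 4 * g)
      reorder = solve-∀
    4Y≈ : + 4 * ∑ₚ (λ x → g (x * x)) ≈ 1ℤ + 1ℤ - - ε - (1ℤ + 1ℤ) * H
    4Y≈ = ≈-trans (≡⇒≈ (sym (∑ₚ-*ˡ (+ 4) (λ x → g (x * x)))))
                  (≈-trans (∑ₚ-cong≈ (λ x → ≈-trans (4*g[x²]≈4g[x²] x) (≡⇒≈ (sym (ℤₚ.*-identityˡ (4g[x²] x))))))
                           ∑ₚ4g[x²]≈)

  H≈ε*c^m : H ≈ ε * c ^ m
  H≈ε*c^m = ≈-trans (^-cong m -h-h≈-c) (≡⇒≈ (trans (cong (_^ m) (sym (ℤₚ.-1*i≡-i c))) (^-distrib-* (- 1ℤ) c m)))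

  Z≡ε*c^m*½^m : Z ≡ ε * c ^ m * ½ ^ m
  Z≡ε*c^m*½^m = trans (cong (_^ m) (lemma c ½)) (trans (^-distrib-* (- 1ℤ * c) ½ m) (cong (_* ½ ^ m) (^-distrib-* (- 1ℤ) c m)))
    where
    lemma : ∀ c t → 0ℤ - c * t ≡ - 1ℤ * c * t
    lemma = solve-∀

  64*sum≈ : ∀ L → IsResidueSet p (quartic c e) L →
            + 64 * + sum L ≈ V ε (c ^ m) (½ ^ m) * (c * c) + + 8 * W ε (c ^ m) (½ ^ m) * e
  64*sum≈ L res = begin
      + 64 * + sum L
    ≡⟨ ℤₚ.*-assoc (+ 8) (+ 8) (+ sum L) ⟩
      + 8 * (+ 8 * + sum L)
    ≈⟨ *-congˡ (+ 8) (8*sum≈ L res) ⟩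
      + 8 * (h * h * (+ 2 - + m * ε - + 2 * H) + k * (+ 4 + ε - + 2 * H + + 2 * Z))
    ≈⟨ *-congˡ (+ 8) (+-cong (*-congˡ (h * h) (minus-congˡ (+ 2 - + m * ε) (*-congˡ (+ 2) H≈ε*c^m)))
                             (*-congˡ k (+-cong (minus-congˡ (+ 4 + ε) (*-congˡ (+ 2) H≈ε*c^m))
                                                (≡⇒≈ (cong (+ 2 *_) Z≡ε*c^m*½^m))))) ⟩
      + 8 * (h * h * (+ 2 - + m * ε - + 2 * (ε * γ)) + k * (+ 4 + ε - + 2 * (ε * γ) + + 2 * (ε * γ * σ)))
    ≡⟨ trans (identity c e (+ m) ε γ σ) (cong (λ z → V ε γ σ * (c * c) + + 8 * W ε γ σ * e + quotient * z) (sym p≡1+2m)) ⟩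
      V ε γ σ * (c * c) + + 8 * W ε γ σ * e + quotient * + p
    ≈⟨ +-congˡ (V ε γ σ * (c * c) + + 8 * W ε γ σ * e) (k*p≈0 quotient) ⟩
      V ε γ σ * (c * c) + + 8 * W ε γ σ * e + 0ℤ
    ≡⟨ ℤₚ.+-identityʳ _ ⟩
      V ε γ σ * (c * c) + + 8 * W ε γ σ * e
    ∎
    where
    open ≈-Reasoning
    γ = c ^ m
    σ = ½ ^ m
    -- The congruence 8·[…] ≡ V c² + 8 W e (mod p) uses only 2·½ = p + 1 and 2m = p − 1.
    Q : ℤ → ℤ → ℤ → ℤ → ℤ → ℤ
    Q c M ε γ σ = c * c * (- + 4 * (1ℤ + ε * γ * σ) * (+ 3 + + 2 * M) - ε * (+ 4 * (1ℤ + M) * (1ℤ + M) + + 2 * (1ℤ + M) + 1ℤ))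
    quotient = Q c (+ m) ε γ σ
    identity : ∀ c e M ε γ σ →
      + 8 * (c * (1ℤ + M) * (c * (1ℤ + M)) * (+ 2 - M * ε - + 2 * (ε * γ))
             + (e - c * (1ℤ + M) * (c * (1ℤ + M))) * (+ 4 + ε - + 2 * (ε * γ) + + 2 * (ε * γ * σ)))
      ≡ (- + 4 - ε - + 4 * (ε * γ * σ)) * (c * c) + + 8 * (+ 4 + ε - + 2 * (ε * γ) + + 2 * (ε * γ * σ)) * e
        + c * c * (- + 4 * (1ℤ + ε * γ * σ) * (+ 3 + + 2 * M) - ε * (+ 4 * (1ℤ + M) * (1ℤ + M) + + 2 * (1ℤ + M) + 1ℤ))
          * (1ℤ + (M + M))
    identity = solve-∀

  c^m≈legendre : ∀ {s} → Legendre p c s → c ^ m ≈ s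
  c^m≈legendre (leg-zero p∣c)                  = ⊥-elim (p∤c p∣c)
  c^m≈legendre (leg-res _ (x , p∣x²-c))        = IsSquare⇒z^m≈1 c (x , ∣⇒≈0′ p∣x²-c) c≉0
  c^m≈legendre (leg-nonres _ ¬square) =
    [ (λ c^m≈1 → ⊥-elim (¬square (Product.map₂ ≈0⇒∣′ (z^m≈1⇒IsSquare c c^m≈1)))) , id ]′ (x^m≈1⊎x^m≈-1 c c≉0)

  sum-CongVW : ∀ L → IsResidueSet p (quartic c e) L → ∀ {ε′ γ′ σ′} → ε ≈ ε′ → c ^ m ≈ γ′ → ½ ^ m ≈ σ′ →
               CongVW p (+ sum L) c e (V ε′ γ′ σ′) (W ε′ γ′ σ′)
  sum-CongVW L res {ε′} {γ′} {σ′} ε≈ γ≈ σ≈ =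
    CongVW-from-64 p {+ sum L} {c} {e} {V ε′ γ′ σ′} {W ε′ γ′ σ′}
      (≈-trans (64*sum≈ L res) (+-cong (*-congʳ (c * c) V≈) (*-congʳ e (*-congˡ (+ 8) W≈))))
    where
    εγ≈ = *-cong ε≈ γ≈
    εγσ≈ = *-cong εγ≈ σ≈
    V≈ = minus-cong (minus-congˡ (- + 4) ε≈) (*-congˡ (+ 4) εγσ≈)
    W≈ = +-cong (minus-cong (+-congˡ (+ 4) ε≈) (*-congˡ (+ 2) εγ≈)) (*-congˡ (+ 2) εγσ≈)

odd-prime≥7 : ∀ {p} → Prime p → 7 ℕ.≤ p → ∃ λ m → suc (m ℕ.+ m) ≡ p × 3 ℕ.≤ m
odd-prime≥7 {p} p-prime 7≤p with p % 2 | m≡m%n+[m/n]*n p 2 | m%n<n p 2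
... | 0 | p≡[p/2]*2 | _ =
  ⊥-elim ([ (λ ()) , (λ 2≡p → ℕₚ.<⇒≱ (ℕₚ.≤-trans (s≤s (s≤s (s≤s z≤n))) 7≤p) (ℕₚ.≤-reflexive (sym 2≡p))) ]′
            (prime⇒irreducible p-prime (ℕ∣.divides (p / 2) p≡[p/2]*2)))
... | 1 | p≡1+[p/2]*2 | _ = p / 2 , sym p≡1+2q , 7≤1+2q⇒3≤q (p / 2) (subst (7 ℕ.≤_) p≡1+2q 7≤p)
  where
  p≡1+2q : p ≡ suc (p / 2 ℕ.+ p / 2)
  p≡1+2q = trans p≡1+[p/2]*2 (cong suc (trans (ℕₚ.*-comm (p / 2) 2) (cong (p / 2 ℕ.+_) (ℕₚ.+-identityʳ (p / 2)))))
  7≤1+2q⇒3≤q : ∀ q → 7 ℕ.≤ suc (q ℕ.+ q) → 3 ℕ.≤ q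
  7≤1+2q⇒3≤q 0 (s≤s ())
  7≤1+2q⇒3≤q 1 (s≤s (s≤s (s≤s ())))
  7≤1+2q⇒3≤q 2 (s≤s (s≤s (s≤s (s≤s (s≤s ())))))
  7≤1+2q⇒3≤q (suc (suc (suc q))) _ = s≤s (s≤s (s≤s z≤n))
... | suc (suc _) | _ | s≤s (s≤s ())

mainTheorem1 :
    (p : ℕ) → Prime p → 7 ≤ p → (c e : ℤ) → ¬ (+ p ∣ c) →
    (L : List ℕ) → IsResidueSet p (quartic c e) L →
      ((p % 8 ≡ 1 → Legendre p c (+ 1) → CongVW p (+ sum L) c e (- (+ 9)) (+ 5))
      × (p % 8 ≡ 3 → Legendre p c (+ 1) → CongVW p (+ sum L) c e (- (+ 7)) (+ 7))
      × (p % 8 ≡ 5 → Legendre p c (+ 1) → CongVW p (+ sum L) c e (- (+ 1)) (+ 1))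
      × (p % 8 ≡ 7 → Legendre p c (+ 1) → CongVW p (+ sum L) c e (+ 1) (+ 3))
      × (p % 8 ≡ 1 → Legendre p c (- (+ 1)) → CongVW p (+ sum L) c e (- (+ 1)) (+ 5))
      × (p % 8 ≡ 3 → Legendre p c (- (+ 1)) → CongVW p (+ sum L) c e (+ 1) (- (+ 1)))
      × (p % 8 ≡ 5 → Legendre p c (- (+ 1)) → CongVW p (+ sum L) c e (- (+ 9)) (+ 9))
      × (p % 8 ≡ 7 → Legendre p c (- (+ 1)) → CongVW p (+ sum L) c e (- (+ 7)) (+ 3)))
mainTheorem1 _ p-prime 7≤p c e p∤c L res with odd-prime≥7 p-prime 7≤p
... | m , refl , 3≤m = case 0 , case 1 , case 2 , case 3 , case 0 , case 1 , case 2 , case 3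
  where
  open QuarticResidues m p-prime 3≤m c e p∤c
  -- For the literals j = 0, 1, 2, 3 and s = ±1, V and W compute to the entries of the table.
  case : ∀ j {s} → p % 8 ≡ suc (j ℕ.+ j) → Legendre p c s →
         CongVW p (+ sum L) c e (V ((- 1ℤ) ^ j) s (re-iⁿ j - im-iⁿ j)) (W ((- 1ℤ) ^ j) s (re-iⁿ j - im-iⁿ j))
  case j p%8≡1+2j legendre =
    sum-CongVW L res (≡⇒≈ (proj₁ (p%8≡1+2j⇒ j p%8≡1+2j))) (c^m≈legendre legendre) (proj₂ (p%8≡1+2j⇒ j p%8≡1+2j))
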